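{- Let $n \geq 3$ be odd, $p = \frac{n+1}{2}$, and $g = am - pc \in \mathrm{OS}_n$. Then $a g^{p-1} = (p-1)\, m g^{p-1}$.
   Context: $\mathrm{OS}_n$ is the quotient of the exterior algebra over $\mathbb{Q}$ on generators $e_{ij}$, $1 \leq i < j \leq n+1$ (each of degree $1$), by the two-sided ideal generated by $e_{ik}e_{jk} - e_{ij}e_{jk} + e_{ij}e_{ik}$ for $1 \leq i<j<k \leq n+1$. Define $a = \sum_{1\leq i<j\leq n} e_{ij}$, $m = \sum_{1 \leq i \leq n} e_{i,n+1}$, and $c = \sum_{1 \leq i<j\leq n}\big(e_{ij}e_{i,n+1} + e_{ij}e_{j,n+1}\big)$ in $\mathrm{OS}_n$. For odd $n$, $\lfloor\frac{n+1}{2}\rfloor = \frac{n+1}{2}$. -}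

module Defs where

open import Data.Nat as ℕ using (ℕ; zero; suc)
open import Data.Fin as Fin using (Fin; toℕ; _<_; _<?_)
open import Data.Integer using (+_)
open import Data.Rational using (ℚ; 0ℚ; 1ℚ; _+_; _*_; -_; _/_)
open import Data.List using (List; []; _∷_; _++_; map; concatMap; foldr; filterᵇ)
open import Data.List using () renaming (allFin to allFinL)
open import Data.Product using (Σ; Σ-syntax; _×_; _,_; proj₁; proj₂)
open import Data.Bool using (Bool; true; false; _∧_; _∨_)
open import Relation.Binary.PropositionalEquality using (_≡_)
open import Relation.Nullary.Decidable using (does)

-- Generators e_{ij}, 1 ≤ i < j ≤ n+1, are encoded as pairs (i , j) of
-- elements of Fin (suc n) (0-based: paper index = toℕ + 1) with i < j.

Gen : ℕ → Set
Gen n = Σ[ i ∈ Fin (suc n) ] Σ[ j ∈ Fin (suc n) ] i < j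

src tgt : ∀ {n} → Gen n → Fin (suc n)
src (i , _ , _) = i
tgt (_ , j , _) = j

gens : (n : ℕ) → List (Gen n)
gens n = concatMap (λ i → concatMap (λ j → pick i j) (allFinL (suc n))) (allFinL (suc n))
  where
  pick : Fin (suc n) → Fin (suc n) → List (Gen n)
  pick i j with i <? j
  ... | Relation.Nullary.Decidable.yes p = (i , j , p) ∷ []
  ... | Relation.Nullary.Decidable.no _ = []

-- Free associative ℚ-algebra on the generators: formal ℚ-linear
-- combinations of words (equality: coefficientwise, see _≋_).

Word : ℕ → Set
Word n = List (Gen n)

FA : ℕ → Set
FA n = List (ℚ × Word n)

genEqᵇ : ∀ {n} → Gen n → Gen n → Bool
genEqᵇ g h = (toℕ (src g) ℕ.≡ᵇ toℕ (src h)) ∧ (toℕ (tgt g) ℕ.≡ᵇ toℕ (tgt h))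

wordEqᵇ : ∀ {n} → Word n → Word n → Bool
wordEqᵇ [] [] = true
wordEqᵇ (g ∷ u) (h ∷ v) = genEqᵇ g h ∧ wordEqᵇ u v
wordEqᵇ _ _ = false

coeff : ∀ {n} → Word n → FA n → ℚ
coeff w x = foldr (λ t s → (if wordEqᵇ w (proj₂ t) then proj₁ t else 0ℚ) + s) 0ℚ x
  where open import Data.Bool using (if_then_else_)

_≋_ : ∀ {n} → FA n → FA n → Set
x ≋ y = ∀ w → coeff w x ≡ coeff w y

ι : ∀ {n} → ℚ → FA n
ι q = (q , []) ∷ []

gen : ∀ {n} → Gen n → FA n
gen g = (1ℚ , g ∷ []) ∷ []

_⊕_ : ∀ {n} → FA n → FA n → FA n
x ⊕ y = x ++ y

_·_ : ∀ {n} → ℚ → FA n → FA n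
q · x = map (λ t → (q * proj₁ t , proj₂ t)) x

⊖_ : ∀ {n} → FA n → FA n
⊖ x = (- 1ℚ) · x

_⊗_ : ∀ {n} → FA n → FA n → FA n
x ⊗ y = concatMap (λ s → map (λ t → (proj₁ s * proj₁ t , proj₂ s ++ proj₂ t)) y) x

_^^_ : ∀ {n} → FA n → ℕ → FA n
x ^^ zero = ι 1ℚ
x ^^ suc k = x ⊗ (x ^^ k)

sumFA : ∀ {n} → List (FA n) → FA n
sumFA = foldr _⊕_ []

ℕ→ℚ : ℕ → ℚ
ℕ→ℚ k = (+ k) / 1

-- Relators of the two-sided ideal defining OS_n as a quotient of the
-- free algebra: exterior-algebra relations (x_g² and x_g x_h + x_h x_g,
-- which generate the same ideal as {v ⊗ v | v ∈ V}) and the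
-- Orlik–Solomon relations e_ik e_jk − e_ij e_jk + e_ij e_ik (i<j<k).

data Relator (n : ℕ) : Set where
  square : Gen n → Relator n
  anti   : Gen n → Gen n → Relator n
  os     : (i j k : Fin (suc n)) → i < j → j < k → Relator n

relator : ∀ {n} → Relator n → FA n
relator (square g) = gen g ⊗ gen g
relator (anti g h) = (gen g ⊗ gen h) ⊕ (gen h ⊗ gen g)
relator (os i j k i<j j<k) =
  (gen ik ⊗ gen jk) ⊕ ((⊖ (gen ij ⊗ gen jk)) ⊕ (gen ij ⊗ gen ik))
  where
  ij jk ik : _
  ij = i , j , i<j
  jk = j , k , j<k
  ik = i , k , Data.Fin.Properties.<-trans i<j j<k
    where import Data.Fin.Properties

InIdeal : ∀ {n} → FA n → Set
InIdeal {n} x =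
  Σ[ L ∈ List (ℚ × Word n × Relator n × Word n) ]
    x ≋ sumFA (map (λ { (q , u , r , v) → q · (((1ℚ , u) ∷ []) ⊗ (relator r ⊗ ((1ℚ , v) ∷ []))) }) L)

_≈OS_ : ∀ {n} → FA n → FA n → Set
x ≈OS y = InIdeal (x ⊕ (⊖ y))

-- The elements a, m, c (paper indices; here vertex n+1 is Fin index n).

isLast : ∀ {n} → Fin (suc n) → Bool
isLast {n} j = toℕ j ℕ.≡ᵇ n

notLast : ∀ {n} → Fin (suc n) → Bool
notLast {n} j = toℕ j ℕ.<ᵇ n

aOS : (n : ℕ) → FA n
aOS n = sumFA (map gen (filterᵇ (λ g → notLast (tgt g)) (gens n)))

mOS : (n : ℕ) → FA n
mOS n = sumFA (map gen (filterᵇ (λ g → isLast (tgt g)) (gens n)))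

-- c = Σ_{1≤i<j≤n} (e_ij e_{i,n+1} + e_ij e_{j,n+1})
cOS : (n : ℕ) → FA n
cOS n = sumFA (map term (filterᵇ (λ g → notLast (tgt g)) (gens n)))
  where
  lastFrom : Fin (suc n) → FA n
  lastFrom v = sumFA (map gen (filterᵇ (λ h → isLast (tgt h) ∧ (toℕ (src h) ℕ.≡ᵇ toℕ v)) (gens n)))
  term : Gen n → FA n
  term g = (gen g ⊗ lastFrom (src g)) ⊕ (gen g ⊗ lastFrom (tgt g))

-- Let ∂ be the Orlik–Solomon boundary map, the derivation of degree −1 with ∂ e_ij = 1.
-- It maps the defining ideal into itself, so it acts on OS_n.  Since g has degree 2 it
-- commutes with the degree-1 element ∂g, hence ∂(g^p) = p · ∂g · g^(p−1).  But g^p has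
-- degree 2p = n + 1, and OS_n vanishes above degree n: a monomial in n + 1 generators
-- contains two generators with the same target vertex, and the Orlik–Solomon relation
-- rewrites it into monomials with a smaller sum of targets.  So ∂g · g^(p−1) = 0.
-- Counting generators gives ∂(am) = C(n,2) m − n a and ∂c = (n − 1) m − 2a, and with
-- n = 2p − 1 this is ∂g = a − (p − 1) m.

module Submission where

open import Defs
open import Data.Bool using (Bool; true; false; _∧_; if_then_else_; T)
open import Data.Empty using (⊥-elim)
open import Data.Fin as Fin using (Fin; toℕ)
import Data.Fin.Properties as Finₚ
import Data.Integer as ℤ
import Data.Integer.Properties as ℤₚ
open import Data.List using (List; []; _∷_; _++_; [_]; map; concatMap; length; filterᵇ; tabulate; lookup; applyUpTo; upTo)
open import Data.List using () renaming (allFin to allFinL)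
import Data.List.Properties as Listₚ
open import Data.List.Relation.Binary.Permutation.Propositional as ↭ using (_↭_)
import Data.List.Relation.Binary.Permutation.Propositional.Properties as ↭ₚ
open import Data.List.Relation.Unary.All as All using (All; []; _∷_)
import Data.List.Relation.Unary.All.Properties as Allₚ
open import Data.Nat as ℕ using (ℕ; zero; suc; _≥_; _%_; _/_; _∸_)
open import Data.Nat.Coprimality using (1-coprimeTo)
import Data.Nat.Coprimality as Coprime
open import Data.Nat.DivMod using (m≡m%n+[m/n]*n; m*n/n≡m)
open import Data.Nat.ListAction using (sum)
open import Data.Nat.ListAction.Properties using (sum-++; sum-↭)
import Data.Nat.Properties as ℕₚ
open import Data.Product using (Σ-syntax; ∃-syntax; _×_; _,_; proj₁; proj₂)
open import Data.Rational as ℚ using (ℚ; 0ℚ; 1ℚ; ½; _+_; _*_; -_; mkℚ)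
open import Data.Rational.Properties
open import Data.Sum using (inj₁; inj₂)
open import Function using (_∘_)
open import Relation.Binary.Definitions using (tri<; tri≈; tri>)
open import Relation.Binary.PropositionalEquality using (_≡_; refl; sym; trans; cong; cong₂; subst; subst₂; module ≡-Reasoning)
open import Relation.Nullary using (¬_; yes; no)
open import Relation.Nullary.Decidable using (dec⇒maybe)
open import Tactic.RingSolver using (solve-∀)
open import Tactic.RingSolver.Core.AlmostCommutativeRing using (AlmostCommutativeRing; fromCommutativeRing)

open ≡-Reasoning

variable
  A B : Set
  n : ℕ

ℚ-ring : AlmostCommutativeRing _ _
ℚ-ring = fromCommutativeRing +-*-commutativeRing (λ x → dec⇒maybe (0ℚ ℚ.≟ x))

∑ : List A → (A → ℚ) → ℚ
∑ [] f = 0ℚ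
∑ (a ∷ as) f = f a + ∑ as f

∑< : ℕ → (ℕ → ℚ) → ℚ
∑< m f = ∑ (upTo m) f

infixr 10 ∑ ∑<
syntax ∑ L (λ x → e) = ∑[ x ∈ L ] e
syntax ∑< m (λ i → e) = ∑[ i < m ] e

when : Bool → ℚ → ℚ
when b x = if b then x else 0ℚ

∑-cong : (L : List A) {f g : A → ℚ} → (∀ a → f a ≡ g a) → ∑ L f ≡ ∑ L g
∑-cong [] e = refl
∑-cong (a ∷ L) e = cong₂ _+_ (e a) (∑-cong L e)

∑-++ : (L K : List A) (f : A → ℚ) → ∑ (L ++ K) f ≡ ∑ L f + ∑ K f
∑-++ [] K f = sym (+-identityˡ _)
∑-++ (a ∷ L) K f = trans (cong (f a +_) (∑-++ L K f)) (sym (+-assoc (f a) _ _))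

∑-map : (h : A → B) (L : List A) (f : B → ℚ) → ∑ (map h L) f ≡ ∑ L (f ∘ h)
∑-map h [] f = refl
∑-map h (a ∷ L) f = cong (f (h a) +_) (∑-map h L f)

∑-concatMap : (h : A → List B) (L : List A) (f : B → ℚ) → ∑ (concatMap h L) f ≡ ∑[ a ∈ L ] ∑ (h a) f
∑-concatMap h [] f = refl
∑-concatMap h (a ∷ L) f = trans (∑-++ (h a) (concatMap h L) f) (cong (∑ (h a) f +_) (∑-concatMap h L f))

∑-0 : (L : List A) → ∑[ a ∈ L ] 0ℚ ≡ 0ℚ
∑-0 [] = refl
∑-0 (a ∷ L) = trans (+-identityˡ _) (∑-0 L)

∑-+ : (L : List A) (f g : A → ℚ) → ∑[ a ∈ L ] (f a + g a) ≡ ∑ L f + ∑ L g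
∑-+ [] f g = sym (+-identityˡ 0ℚ)
∑-+ (a ∷ L) f g = trans (cong (f a + g a +_) (∑-+ L f g)) (+-interchange (f a) (g a) (∑ L f) (∑ L g))
  where
  +-interchange : ∀ w x y z → (w + x) + (y + z) ≡ (w + y) + (x + z)
  +-interchange = solve-∀ ℚ-ring

∑-*ˡ : (c : ℚ) (L : List A) (f : A → ℚ) → ∑[ a ∈ L ] (c * f a) ≡ c * ∑ L f
∑-*ˡ c [] f = sym (*-zeroʳ c)
∑-*ˡ c (a ∷ L) f = trans (cong (c * f a +_) (∑-*ˡ c L f)) (sym (*-distribˡ-+ c (f a) (∑ L f)))

∑-neg : (L : List A) (f : A → ℚ) → ∑[ a ∈ L ] (- f a) ≡ - ∑ L f
∑-neg [] f = refl
∑-neg (a ∷ L) f = trans (cong (- f a +_) (∑-neg L f)) (sym (neg-distrib-+ (f a) (∑ L f)))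

∑-comm : (L : List A) (K : List B) (F : A → B → ℚ) → ∑[ a ∈ L ] ∑[ b ∈ K ] F a b ≡ ∑[ b ∈ K ] ∑[ a ∈ L ] F a b
∑-comm [] K F = sym (∑-0 K)
∑-comm (a ∷ L) K F = trans (cong (∑ K (F a) +_) (∑-comm L K F)) (sym (∑-+ K (F a) _))

∑-congᴬ : {P : A → Set} {L : List A} {f g : A → ℚ} → All P L → (∀ a → P a → f a ≡ g a) → ∑ L f ≡ ∑ L g
∑-congᴬ [] e = refl
∑-congᴬ (pa ∷ ps) e = cong₂ _+_ (e _ pa) (∑-congᴬ ps e)

∑-filterᵇ : (P : A → Bool) (L : List A) (f : A → ℚ) → ∑ (filterᵇ P L) f ≡ ∑[ a ∈ L ] when (P a) (f a)
∑-filterᵇ P [] f = refl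
∑-filterᵇ P (a ∷ L) f with P a
... | true = cong (f a +_) (∑-filterᵇ P L f)
... | false = trans (∑-filterᵇ P L f) (sym (+-identityˡ _))

∑-filterᵇ-cong : (P : A → Bool) (L : List A) {f f' : A → ℚ} → (∀ a → T (P a) → f a ≡ f' a) →
                 ∑ (filterᵇ P L) f ≡ ∑ (filterᵇ P L) f'
∑-filterᵇ-cong P [] e = refl
∑-filterᵇ-cong P (a ∷ L) e with P a in Pa
... | true = cong₂ _+_ (e a (subst T (sym Pa) _)) (∑-filterᵇ-cong P L e)
... | false = ∑-filterᵇ-cong P L e

when-T : {b : Bool} (x : ℚ) → T b → when b x ≡ x
when-T {true} x _ = refl

when-¬T : {b : Bool} (x : ℚ) → ¬ T b → when b x ≡ 0ℚ
when-¬T {true} x ¬t = ⊥-elim (¬t _)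
when-¬T {false} x _ = refl

count : List A → ℚ
count L = ∑[ _ ∈ L ] 1ℚ

∑-const : (L : List A) (c : ℚ) → ∑[ _ ∈ L ] c ≡ count L * c
∑-const L c = trans (∑-cong L (λ _ → sym (*-identityʳ c))) (trans (∑-*ˡ c L (λ _ → 1ℚ)) (*-comm c (count L)))

∑∑-difference : (L : List A) (K : List B) (f : B → ℚ) (e : A → ℚ) →
                ∑[ a ∈ L ] ∑[ b ∈ K ] (f b + - e a) ≡ count L * ∑ K f + - (count K * ∑ L e)
∑∑-difference L K f e = begin
  ∑[ a ∈ L ] ∑[ b ∈ K ] (f b + - e a)             ≡⟨ ∑-cong L (λ a → trans (∑-+ K f _) (cong (∑ K f +_) (∑-const K (- e a)))) ⟩
  ∑[ a ∈ L ] (∑ K f + count K * - e a)            ≡⟨ trans (∑-+ L _ _) (cong₂ _+_ (∑-const L (∑ K f)) (∑-*ˡ (count K) L _)) ⟩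
  count L * ∑ K f + count K * ∑[ a ∈ L ] (- e a)  ≡⟨ cong (λ s → count L * ∑ K f + count K * s) (∑-neg L e) ⟩
  count L * ∑ K f + count K * - ∑ L e             ≡⟨ cong (count L * ∑ K f +_) (sym (neg-distribʳ-* (count K) (∑ L e))) ⟩
  count L * ∑ K f + - (count K * ∑ L e)           ∎

ℕ→ℚ-mkℚ : (m : ℕ) → ℕ→ℚ m ≡ mkℚ (ℤ.+ m) 0 (Coprime.sym (1-coprimeTo m))
ℕ→ℚ-mkℚ m = normalize-coprime (Coprime.sym (1-coprimeTo m))

ℕ→ℚ-suc : (m : ℕ) → ℕ→ℚ (suc m) ≡ 1ℚ + ℕ→ℚ m
ℕ→ℚ-suc m = begin
  (ℤ.+ suc m) ℚ./ 1                                       ≡⟨ cong (λ k → (ℤ.+ 1 ℤ.+ k) ℚ./ 1) (sym (ℤₚ.*-identityʳ (ℤ.+ m))) ⟩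
  (ℤ.+ 1 ℤ.* ℤ.+ 1 ℤ.+ ℤ.+ m ℤ.* ℤ.+ 1) ℚ./ 1           ≡⟨⟩
  1ℚ + mkℚ (ℤ.+ m) 0 (Coprime.sym (1-coprimeTo m))       ≡⟨ cong (1ℚ +_) (sym (ℕ→ℚ-mkℚ m)) ⟩
  1ℚ + ℕ→ℚ m                                              ∎

ℕ→ℚ-double : (k : ℕ) → ℕ→ℚ (k ℕ.* 2) ≡ ℕ→ℚ k + ℕ→ℚ k
ℕ→ℚ-double zero = refl
ℕ→ℚ-double (suc k) = begin
  ℕ→ℚ (suc (suc (k ℕ.* 2)))           ≡⟨ trans (ℕ→ℚ-suc (suc (k ℕ.* 2))) (cong (1ℚ +_) (ℕ→ℚ-suc (k ℕ.* 2))) ⟩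
  1ℚ + (1ℚ + ℕ→ℚ (k ℕ.* 2))           ≡⟨ cong (λ a → 1ℚ + (1ℚ + a)) (ℕ→ℚ-double k) ⟩
  1ℚ + (1ℚ + (ℕ→ℚ k + ℕ→ℚ k))         ≡⟨ regroup (ℕ→ℚ k) ⟩
  (1ℚ + ℕ→ℚ k) + (1ℚ + ℕ→ℚ k)         ≡⟨ sym (cong₂ _+_ (ℕ→ℚ-suc k) (ℕ→ℚ-suc k)) ⟩
  ℕ→ℚ (suc k) + ℕ→ℚ (suc k)           ∎
  where
  regroup : ∀ a → 1ℚ + (1ℚ + (a + a)) ≡ (1ℚ + a) + (1ℚ + a)
  regroup = solve-∀ ℚ-ring

ℕ→ℚ-odd : (k : ℕ) → ℕ→ℚ (suc (k ℕ.* 2)) ≡ 1ℚ + (ℕ→ℚ k + ℕ→ℚ k)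
ℕ→ℚ-odd k = trans (ℕ→ℚ-suc (k ℕ.* 2)) (cong (1ℚ +_) (ℕ→ℚ-double k))

double-injective : (a b : ℚ) → a + a ≡ b + b → a ≡ b
double-injective a b a+a≡b+b = trans (sym (halve a)) (trans (cong (_* ½) a+a≡b+b) (halve b))
  where
  halve : ∀ x → (x + x) * ½ ≡ x
  halve = solve-∀ ℚ-ring

∑<-suc : (m : ℕ) (f : ℕ → ℚ) → ∑[ i < suc m ] f i ≡ ∑[ i < m ] f i + f m
∑<-suc m f = begin
  ∑ (upTo (suc m)) f        ≡⟨ cong (λ L → ∑ L f) (sym (Listₚ.upTo-∷ʳ m)) ⟩
  ∑ (upTo m ++ [ m ]) f     ≡⟨ ∑-++ (upTo m) [ m ] f ⟩
  ∑ (upTo m) f + (f m + 0ℚ) ≡⟨ cong (∑ (upTo m) f +_) (+-identityʳ (f m)) ⟩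
  ∑ (upTo m) f + f m        ∎

∑<-cong : (m : ℕ) {f g : ℕ → ℚ} → (∀ i → i ℕ.< m → f i ≡ g i) → ∑[ i < m ] f i ≡ ∑[ i < m ] g i
∑<-cong zero e = refl
∑<-cong (suc m) {f} {g} e = begin
  ∑[ i < suc m ] f i   ≡⟨ ∑<-suc m f ⟩
  ∑[ i < m ] f i + f m ≡⟨ cong₂ _+_ (∑<-cong m (λ i i<m → e i (ℕₚ.m<n⇒m<1+n i<m))) (e m ℕₚ.≤-refl) ⟩
  ∑[ i < m ] g i + g m ≡⟨ sym (∑<-suc m g) ⟩
  ∑[ i < suc m ] g i   ∎

count-upTo : (m : ℕ) → count (upTo m) ≡ ℕ→ℚ m
count-upTo zero = refl
count-upTo (suc m) = trans (∑<-suc m (λ _ → 1ℚ)) (trans (cong (_+ 1ℚ) (count-upTo m)) (trans (+-comm (ℕ→ℚ m) 1ℚ) (sym (ℕ→ℚ-suc m))))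

∑-tabulate : {m k : ℕ} (s : Fin m → Fin k) (h : ℕ → ℕ) → (∀ i → toℕ (s i) ≡ h (toℕ i)) →
             (F : ℕ → ℚ) → ∑[ i ∈ tabulate s ] F (toℕ i) ≡ ∑ (applyUpTo h m) F
∑-tabulate {zero} s h e F = refl
∑-tabulate {suc m} s h e F = cong₂ _+_ (cong F (e Fin.zero)) (∑-tabulate (s ∘ Fin.suc) (h ∘ suc) (e ∘ Fin.suc) F)

∑-below : (h : ℕ → ℚ) (j N : ℕ) → j ℕ.≤ N → ∑[ i < N ] when (i ℕ.<ᵇ j) (h i) ≡ ∑[ i < j ] h i
∑-below h j N j≤N with ℕₚ.m≤n⇒m<n∨m≡n j≤N
∑-below h j (suc N) _ | inj₁ (ℕ.s≤s j≤N) = begin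
  ∑[ i < suc N ] when (i ℕ.<ᵇ j) (h i)                   ≡⟨ ∑<-suc N _ ⟩
  ∑[ i < N ] when (i ℕ.<ᵇ j) (h i) + when (N ℕ.<ᵇ j) (h N) ≡⟨ cong₂ _+_ (∑-below h j N j≤N) (when-¬T (h N) (ℕₚ.≤⇒≯ j≤N ∘ ℕₚ.<ᵇ⇒< N j)) ⟩
  ∑[ i < j ] h i + 0ℚ                                    ≡⟨ +-identityʳ _ ⟩
  ∑[ i < j ] h i                                         ∎
∑-below h j j _ | inj₂ refl = ∑<-cong j (λ i i<j → when-T (h i) (ℕₚ.<⇒<ᵇ i<j))

∑-pairs : (N : ℕ) (c : ℕ → ℕ → ℚ) → ∑[ i < N ] ∑[ j < N ] when (i ℕ.<ᵇ j) (c i j) ≡ ∑[ j < N ] ∑[ i < j ] c i j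
∑-pairs N c = trans (∑-comm (upTo N) (upTo N) _) (∑<-cong N (λ j j<N → ∑-below (λ i → c i j) j N (ℕₚ.<⇒≤ j<N)))

∑-last-column : (m : ℕ) (F : ℕ → ℕ → ℚ) → ∑[ j < suc m ] ∑[ i < j ] when (j ℕ.≡ᵇ m) (F i j) ≡ ∑[ i < m ] F i m
∑-last-column m F = begin
  ∑[ j < suc m ] ∑[ i < j ] when (j ℕ.≡ᵇ m) (F i j)
    ≡⟨ ∑<-suc m _ ⟩
  ∑[ j < m ] ∑[ i < j ] when (j ℕ.≡ᵇ m) (F i j) + ∑[ i < m ] when (m ℕ.≡ᵇ m) (F i m)
    ≡⟨ cong₂ _+_ (trans (∑<-cong m (λ j j<m → trans (∑-cong (upTo j) (λ i → when-¬T _ (ℕₚ.<⇒≢ j<m ∘ ℕₚ.≡ᵇ⇒≡ j m))) (∑-0 (upTo j))))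
                        (∑-0 (upTo m)))
                 (∑-cong (upTo m) (λ i → when-T _ (ℕₚ.≡⇒≡ᵇ m m refl))) ⟩
  0ℚ + ∑[ i < m ] F i m
    ≡⟨ +-identityˡ _ ⟩
  ∑[ i < m ] F i m ∎

∑-δ : (m v : ℕ) (y : ℚ) → v ℕ.< m → ∑[ i < m ] when (i ℕ.≡ᵇ v) y ≡ y
∑-δ (suc m) v y v<1+m with ℕₚ.m≤n⇒m<n∨m≡n (ℕₚ.≤-pred v<1+m)
... | inj₁ v<m = begin
  ∑[ i < suc m ] when (i ℕ.≡ᵇ v) y    ≡⟨ ∑<-suc m _ ⟩
  ∑[ i < m ] when (i ℕ.≡ᵇ v) y + when (m ℕ.≡ᵇ v) y ≡⟨ cong₂ _+_ (∑-δ m v y v<m) (when-¬T y (ℕₚ.<⇒≢ v<m ∘ sym ∘ ℕₚ.≡ᵇ⇒≡ m v)) ⟩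
  y + 0ℚ                              ≡⟨ +-identityʳ y ⟩
  y                                   ∎
... | inj₂ refl = begin
  ∑[ i < suc v ] when (i ℕ.≡ᵇ v) y    ≡⟨ ∑<-suc v _ ⟩
  ∑[ i < v ] when (i ℕ.≡ᵇ v) y + when (v ℕ.≡ᵇ v) y ≡⟨ cong₂ _+_ (trans (∑<-cong v (λ i i<v → when-¬T y (ℕₚ.<⇒≢ i<v ∘ ℕₚ.≡ᵇ⇒≡ i v))) (∑-0 (upTo v)))
                                                            (when-T y (ℕₚ.≡⇒≡ᵇ v v refl)) ⟩
  0ℚ + y                              ≡⟨ +-identityˡ y ⟩
  y                                   ∎

∑-triangle : (X : ℕ → ℚ) (m : ℕ) → ∑[ j < m ] ∑[ i < j ] (X i + X j) ≡ (ℕ→ℚ m + - 1ℚ) * ∑[ i < m ] X i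
∑-triangle X zero = sym (*-zeroʳ (0ℚ + - 1ℚ))
∑-triangle X (suc m) = begin
  ∑[ j < suc m ] ∑[ i < j ] (X i + X j)
    ≡⟨ ∑<-suc m _ ⟩
  ∑[ j < m ] ∑[ i < j ] (X i + X j) + ∑[ i < m ] (X i + X m)
    ≡⟨ cong₂ _+_ (∑-triangle X m) (trans (∑-+ (upTo m) X (λ _ → X m)) (cong (∑[ i < m ] X i +_) (trans (∑-const (upTo m) (X m)) (cong (_* X m) (count-upTo m))))) ⟩
  (ℕ→ℚ m + - 1ℚ) * ∑[ i < m ] X i + (∑[ i < m ] X i + ℕ→ℚ m * X m)
    ≡⟨ rearrange (ℕ→ℚ m) (∑[ i < m ] X i) (X m) ⟩
  ((1ℚ + ℕ→ℚ m) + - 1ℚ) * (∑[ i < m ] X i + X m)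
    ≡⟨ cong₂ (λ a b → (a + - 1ℚ) * b) (sym (ℕ→ℚ-suc m)) (sym (∑<-suc m X)) ⟩
  (ℕ→ℚ (suc m) + - 1ℚ) * ∑[ i < suc m ] X i ∎
  where
  rearrange : ∀ k s x → (k + - 1ℚ) * s + (s + k * x) ≡ ((1ℚ + k) + - 1ℚ) * (s + x)
  rearrange = solve-∀ ℚ-ring

-- Linear functionals on the free algebra

⟦_⟧ : Word n → FA n
⟦ w ⟧ = (1ℚ , w) ∷ []

lin : (Word n → ℚ) → FA n → ℚ
lin φ x = ∑[ t ∈ x ] (proj₁ t * φ (proj₂ t))

lin-⊕ : (φ : Word n → ℚ) (x y : FA n) → lin φ (x ⊕ y) ≡ lin φ x + lin φ y
lin-⊕ φ x y = ∑-++ x y _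

lin-· : (φ : Word n → ℚ) (c : ℚ) (x : FA n) → lin φ (c · x) ≡ c * lin φ x
lin-· φ c x = begin
  lin φ (c · x)                              ≡⟨ ∑-map _ x _ ⟩
  ∑[ t ∈ x ] (c * proj₁ t * φ (proj₂ t))     ≡⟨ ∑-cong x (λ t → *-assoc c (proj₁ t) _) ⟩
  ∑[ t ∈ x ] (c * (proj₁ t * φ (proj₂ t)))   ≡⟨ ∑-*ˡ c x _ ⟩
  c * lin φ x                                ∎

lin-⊖ : (φ : Word n → ℚ) (x : FA n) → lin φ (⊖ x) ≡ - lin φ x
lin-⊖ φ x = trans (lin-· φ (- 1ℚ) x) (-1*x≡-x (lin φ x))
  where
  -1*x≡-x : ∀ a → - 1ℚ * a ≡ - a
  -1*x≡-x = solve-∀ ℚ-ring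

lin-⊕⊖ : (φ : Word n → ℚ) (x y : FA n) → lin φ (x ⊕ (⊖ y)) ≡ lin φ x + - lin φ y
lin-⊕⊖ φ x y = trans (lin-⊕ φ x (⊖ y)) (cong (lin φ x +_) (lin-⊖ φ y))

lin-combination : (φ : Word n → ℚ) (c d : ℚ) (x y : FA n) → lin φ ((c · x) ⊕ (⊖ (d · y))) ≡ c * lin φ x + - (d * lin φ y)
lin-combination φ c d x y = trans (lin-⊕⊖ φ (c · x) (d · y)) (cong₂ (λ s t → s + - t) (lin-· φ c x) (lin-· φ d y))

lin-cong : {φ ψ : Word n → ℚ} → (∀ w → φ w ≡ ψ w) → (x : FA n) → lin φ x ≡ lin ψ x
lin-cong e x = ∑-cong x (λ t → cong (proj₁ t *_) (e (proj₂ t)))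

lin-+ : (φ ψ : Word n → ℚ) (x : FA n) → lin (λ w → φ w + ψ w) x ≡ lin φ x + lin ψ x
lin-+ φ ψ x = trans (∑-cong x (λ t → *-distribˡ-+ (proj₁ t) _ _)) (∑-+ x _ _)

lin-* : (c : ℚ) (φ : Word n → ℚ) (x : FA n) → lin (λ w → c * φ w) x ≡ c * lin φ x
lin-* c φ x = trans (∑-cong x (λ t → *-comm-middle (proj₁ t) c _)) (∑-*ˡ c x _)
  where
  *-comm-middle : ∀ a b d → a * (b * d) ≡ b * (a * d)
  *-comm-middle = solve-∀ ℚ-ring

lin-0 : (x : FA n) → lin (λ _ → 0ℚ) x ≡ 0ℚ
lin-0 x = trans (∑-cong x (λ t → *-zeroʳ (proj₁ t))) (∑-0 x)

lin-comm : (F : Word n → Word n → ℚ) (x y : FA n) →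
           lin (λ u → lin (F u) y) x ≡ lin (λ v → lin (λ u → F u v) x) y
lin-comm F x y = begin
  ∑[ s ∈ x ] (proj₁ s * lin (F (proj₂ s)) y)
    ≡⟨ ∑-cong x (λ s → sym (lin-* (proj₁ s) (F (proj₂ s)) y)) ⟩
  ∑[ s ∈ x ] ∑[ t ∈ y ] (proj₁ t * (proj₁ s * F (proj₂ s) (proj₂ t)))
    ≡⟨ ∑-comm x y _ ⟩
  ∑[ t ∈ y ] ∑[ s ∈ x ] (proj₁ t * (proj₁ s * F (proj₂ s) (proj₂ t)))
    ≡⟨ ∑-cong y (λ t → ∑-*ˡ (proj₁ t) x _) ⟩
  lin (λ v → lin (λ u → F u v) x) y ∎

lin-⊗ : (φ : Word n → ℚ) (x y : FA n) → lin φ (x ⊗ y) ≡ lin (λ u → lin (λ v → φ (u ++ v)) y) x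
lin-⊗ φ x y = trans (∑-concatMap _ x _) (∑-cong x λ where
  (q , u) → trans (∑-map _ y _) (trans (∑-cong y (λ t → *-assoc q (proj₁ t) _)) (∑-*ˡ q y _)))

lin-⟦⟧ : (φ : Word n → ℚ) (w : Word n) → lin φ ⟦ w ⟧ ≡ φ w
lin-⟦⟧ φ w = trans (+-identityʳ _) (*-identityˡ _)

lin-⟦⟧⊗ : (φ : Word n → ℚ) (u : Word n) (x : FA n) → lin φ (⟦ u ⟧ ⊗ x) ≡ lin (λ v → φ (u ++ v)) x
lin-⟦⟧⊗ φ u x = trans (lin-⊗ φ ⟦ u ⟧ x) (lin-⟦⟧ (λ a → lin (λ v → φ (a ++ v)) x) u)

lin-⊗⟦⟧ : (φ : Word n → ℚ) (x : FA n) (v : Word n) → lin φ (x ⊗ ⟦ v ⟧) ≡ lin (λ u → φ (u ++ v)) x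
lin-⊗⟦⟧ φ x v = trans (lin-⊗ φ x ⟦ v ⟧) (lin-cong (λ u → lin-⟦⟧ (λ b → φ (u ++ b)) v) x)

lin-sandwich : (φ : Word n → ℚ) (u : Word n) (x : FA n) (v : Word n) →
               lin φ (⟦ u ⟧ ⊗ (x ⊗ ⟦ v ⟧)) ≡ lin (λ b → φ (u ++ b ++ v)) x
lin-sandwich φ u x v = trans (lin-⟦⟧⊗ φ u (x ⊗ ⟦ v ⟧)) (lin-⊗⟦⟧ (λ b → φ (u ++ b)) x v)

lin-gen⊗gen : (φ : Word n → ℚ) (g h : Gen n) → lin φ (gen g ⊗ gen h) ≡ φ (g ∷ h ∷ [])
lin-gen⊗gen φ g h = trans (lin-⟦⟧⊗ φ (g ∷ []) (gen h)) (lin-⟦⟧ (λ v → φ (g ∷ v)) (h ∷ []))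

lin-sumFA : (φ : Word n → ℚ) (xs : List (FA n)) → lin φ (sumFA xs) ≡ ∑[ x ∈ xs ] lin φ x
lin-sumFA φ [] = refl
lin-sumFA φ (x ∷ xs) = trans (lin-⊕ φ x (sumFA xs)) (cong (lin φ x +_) (lin-sumFA φ xs))

lin-sumGens : (ψ : Word n → ℚ) (L : List (Gen n)) → lin ψ (sumFA (map gen L)) ≡ ∑[ g ∈ L ] ψ (g ∷ [])
lin-sumGens ψ [] = refl
lin-sumGens ψ (g ∷ L) = trans (lin-⊕ ψ (gen g) (sumFA (map gen L))) (cong₂ _+_ (lin-⟦⟧ ψ (g ∷ [])) (lin-sumGens ψ L))

coeff-lin : (w : Word n) (x : FA n) → coeff w x ≡ lin (λ v → if wordEqᵇ w v then 1ℚ else 0ℚ) x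
coeff-lin w [] = refl
coeff-lin w ((q , v) ∷ x) = cong₂ _+_ (select (wordEqᵇ w v)) (coeff-lin w x)
  where
  select : (b : Bool) → (if b then q else 0ℚ) ≡ q * (if b then 1ℚ else 0ℚ)
  select true = sym (*-identityʳ q)
  select false = sym (*-zeroʳ q)

-- Coefficientwise equality, phrased through all linear functionals so that lin turns
-- ⊕, · and ⊗ into arithmetic in ℚ.
infix 4 _≐_

record _≐_ (x y : FA n) : Set where
  constructor mk≐
  field lin-≡ : (φ : Word n → ℚ) → lin φ x ≡ lin φ y
open _≐_ public

≐-refl : {x : FA n} → x ≐ x
≐-refl = mk≐ λ φ → refl

≐-sym : {x y : FA n} → x ≐ y → y ≐ x
≐-sym x≐y = mk≐ λ φ → sym (lin-≡ x≐y φ)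

≐-trans : {x y z : FA n} → x ≐ y → y ≐ z → x ≐ z
≐-trans x≐y y≐z = mk≐ λ φ → trans (lin-≡ x≐y φ) (lin-≡ y≐z φ)

≐⇒≋ : {x y : FA n} → x ≐ y → x ≋ y
≐⇒≋ {x = x} {y} x≐y w = trans (coeff-lin w x) (trans (lin-≡ x≐y _) (sym (coeff-lin w y)))

⊕-cong : {x x' y y' : FA n} → x ≐ x' → y ≐ y' → x ⊕ y ≐ x' ⊕ y'
⊕-cong {x = x} {x'} {y} {y'} x≐x' y≐y' = mk≐ λ φ →
  trans (lin-⊕ φ x y) (trans (cong₂ _+_ (lin-≡ x≐x' φ) (lin-≡ y≐y' φ)) (sym (lin-⊕ φ x' y')))

⊕-congʳ : (x : FA n) {y y' : FA n} → y ≐ y' → x ⊕ y ≐ x ⊕ y'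
⊕-congʳ x = ⊕-cong (≐-refl {x = x})

·-cong : (c : ℚ) {x y : FA n} → x ≐ y → c · x ≐ c · y
·-cong c {x} {y} x≐y = mk≐ λ φ → trans (lin-· φ c x) (trans (cong (c *_) (lin-≡ x≐y φ)) (sym (lin-· φ c y)))

⊗-congˡ : {x x' : FA n} (y : FA n) → x ≐ x' → x ⊗ y ≐ x' ⊗ y
⊗-congˡ {x = x} {x'} y x≐x' = mk≐ λ φ → trans (lin-⊗ φ x y) (trans (lin-≡ x≐x' _) (sym (lin-⊗ φ x' y)))

⊗-congʳ : (x : FA n) {y y' : FA n} → y ≐ y' → x ⊗ y ≐ x ⊗ y'
⊗-congʳ x {y} {y'} y≐y' = mk≐ λ φ → trans (lin-⊗ φ x y) (trans (lin-cong (λ u → lin-≡ y≐y' _) x) (sym (lin-⊗ φ x y')))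

⊗-assoc : (x y z : FA n) → (x ⊗ y) ⊗ z ≐ x ⊗ (y ⊗ z)
⊗-assoc x y z = mk≐ λ φ → begin
  lin φ ((x ⊗ y) ⊗ z)
    ≡⟨ trans (lin-⊗ φ (x ⊗ y) z) (lin-⊗ _ x y) ⟩
  lin (λ a → lin (λ b → lin (λ c → φ ((a ++ b) ++ c)) z) y) x
    ≡⟨ lin-cong (λ a → lin-cong (λ b → lin-cong (λ c → cong φ (Listₚ.++-assoc a b c)) z) y) x ⟩
  lin (λ a → lin (λ b → lin (λ c → φ (a ++ b ++ c)) z) y) x
    ≡⟨ sym (trans (lin-⊗ φ x (y ⊗ z)) (lin-cong (λ a → lin-⊗ (λ bc → φ (a ++ bc)) y z) x)) ⟩
  lin φ (x ⊗ (y ⊗ z)) ∎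

⊗-distribˡ-⊕ : (x y z : FA n) → x ⊗ (y ⊕ z) ≐ (x ⊗ y) ⊕ (x ⊗ z)
⊗-distribˡ-⊕ x y z = mk≐ λ φ → begin
  lin φ (x ⊗ (y ⊕ z))
    ≡⟨ lin-⊗ φ x (y ⊕ z) ⟩
  lin (λ u → lin (λ v → φ (u ++ v)) (y ⊕ z)) x
    ≡⟨ lin-cong (λ u → lin-⊕ (λ v → φ (u ++ v)) y z) x ⟩
  lin (λ u → lin (λ v → φ (u ++ v)) y + lin (λ v → φ (u ++ v)) z) x
    ≡⟨ lin-+ _ _ x ⟩
  lin (λ u → lin (λ v → φ (u ++ v)) y) x + lin (λ u → lin (λ v → φ (u ++ v)) z) x
    ≡⟨ sym (cong₂ _+_ (lin-⊗ φ x y) (lin-⊗ φ x z)) ⟩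
  lin φ (x ⊗ y) + lin φ (x ⊗ z)
    ≡⟨ sym (lin-⊕ φ (x ⊗ y) (x ⊗ z)) ⟩
  lin φ ((x ⊗ y) ⊕ (x ⊗ z)) ∎

⊗-distribʳ-⊕ : (x y z : FA n) → (x ⊕ y) ⊗ z ≐ (x ⊗ z) ⊕ (y ⊗ z)
⊗-distribʳ-⊕ x y z = mk≐ λ φ → begin
  lin φ ((x ⊕ y) ⊗ z)                                   ≡⟨ lin-⊗ φ (x ⊕ y) z ⟩
  lin (λ u → lin (λ v → φ (u ++ v)) z) (x ⊕ y)          ≡⟨ lin-⊕ _ x y ⟩
  lin (λ u → lin (λ v → φ (u ++ v)) z) x
    + lin (λ u → lin (λ v → φ (u ++ v)) z) y            ≡⟨ sym (cong₂ _+_ (lin-⊗ φ x z) (lin-⊗ φ y z)) ⟩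
  lin φ (x ⊗ z) + lin φ (y ⊗ z)                         ≡⟨ sym (lin-⊕ φ (x ⊗ z) (y ⊗ z)) ⟩
  lin φ ((x ⊗ z) ⊕ (y ⊗ z))                             ∎

⊗-·ˡ : (c : ℚ) (x y : FA n) → (c · x) ⊗ y ≐ c · (x ⊗ y)
⊗-·ˡ c x y = mk≐ λ φ →
  trans (lin-⊗ φ (c · x) y) (trans (lin-· _ c x) (trans (cong (c *_) (sym (lin-⊗ φ x y))) (sym (lin-· φ c (x ⊗ y)))))

⊗-·ʳ : (c : ℚ) (x y : FA n) → x ⊗ (c · y) ≐ c · (x ⊗ y)
⊗-·ʳ c x y = mk≐ λ φ → begin
  lin φ (x ⊗ (c · y))                              ≡⟨ lin-⊗ φ x (c · y) ⟩
  lin (λ u → lin (λ v → φ (u ++ v)) (c · y)) x     ≡⟨ lin-cong (λ u → lin-· (λ v → φ (u ++ v)) c y) x ⟩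
  lin (λ u → c * lin (λ v → φ (u ++ v)) y) x       ≡⟨ lin-* c _ x ⟩
  c * lin (λ u → lin (λ v → φ (u ++ v)) y) x       ≡⟨ cong (c *_) (sym (lin-⊗ φ x y)) ⟩
  c * lin φ (x ⊗ y)                                ≡⟨ sym (lin-· φ c (x ⊗ y)) ⟩
  lin φ (c · (x ⊗ y))                              ∎

⊗-zeroʳ : (x : FA n) → x ⊗ [] ≐ []
⊗-zeroʳ x = mk≐ λ φ → trans (lin-⊗ φ x []) (lin-0 x)

⊗-consˡ : (q : ℚ) (w : Word n) (x y : FA n) → ((q , w) ∷ x) ⊗ y ≐ (q · (⟦ w ⟧ ⊗ y)) ⊕ (x ⊗ y)
⊗-consˡ q w x y = mk≐ λ φ → begin
  lin φ (((q , w) ∷ x) ⊗ y)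
    ≡⟨ lin-⊗ φ ((q , w) ∷ x) y ⟩
  q * lin (λ v → φ (w ++ v)) y + lin (λ u → lin (λ v → φ (u ++ v)) y) x
    ≡⟨ sym (cong₂ _+_ (trans (lin-· φ q (⟦ w ⟧ ⊗ y)) (cong (q *_) (lin-⟦⟧⊗ φ w y))) (lin-⊗ φ x y)) ⟩
  lin φ (q · (⟦ w ⟧ ⊗ y)) + lin φ (x ⊗ y)
    ≡⟨ sym (lin-⊕ φ (q · (⟦ w ⟧ ⊗ y)) (x ⊗ y)) ⟩
  lin φ ((q · (⟦ w ⟧ ⊗ y)) ⊕ (x ⊗ y)) ∎

⊗-consʳ : (q : ℚ) (w : Word n) (x y : FA n) → x ⊗ ((q , w) ∷ y) ≐ (q · (x ⊗ ⟦ w ⟧)) ⊕ (x ⊗ y)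
⊗-consʳ q w x y = mk≐ λ φ → begin
  lin φ (x ⊗ ((q , w) ∷ y))
    ≡⟨ lin-⊗ φ x ((q , w) ∷ y) ⟩
  lin (λ u → q * φ (u ++ w) + lin (λ v → φ (u ++ v)) y) x
    ≡⟨ lin-+ _ _ x ⟩
  lin (λ u → q * φ (u ++ w)) x + lin (λ u → lin (λ v → φ (u ++ v)) y) x
    ≡⟨ cong₂ _+_ (trans (lin-* q _ x) (cong (q *_) (sym (lin-⊗⟦⟧ φ x w)))) (sym (lin-⊗ φ x y)) ⟩
  q * lin φ (x ⊗ ⟦ w ⟧) + lin φ (x ⊗ y)
    ≡⟨ cong (_+ lin φ (x ⊗ y)) (sym (lin-· φ q (x ⊗ ⟦ w ⟧))) ⟩
  lin φ (q · (x ⊗ ⟦ w ⟧)) + lin φ (x ⊗ y)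
    ≡⟨ sym (lin-⊕ φ (q · (x ⊗ ⟦ w ⟧)) (x ⊗ y)) ⟩
  lin φ ((q · (x ⊗ ⟦ w ⟧)) ⊕ (x ⊗ y)) ∎

⊖-involutive : (x : FA n) → ⊖ (⊖ x) ≐ x
⊖-involutive x = mk≐ λ φ → trans (lin-⊖ φ (⊖ x)) (trans (cong -_ (lin-⊖ φ x)) (neg-neg (lin φ x)))
  where
  neg-neg : ∀ a → - (- a) ≡ a
  neg-neg = solve-∀ ℚ-ring

⟦⟧-⊗-⟦⟧ : (a b : Word n) → ⟦ a ⟧ ⊗ ⟦ b ⟧ ≐ ⟦ a ++ b ⟧
⟦⟧-⊗-⟦⟧ a b = mk≐ λ φ → trans (lin-⟦⟧⊗ φ a ⟦ b ⟧) (trans (lin-⟦⟧ (λ v → φ (a ++ v)) b) (sym (lin-⟦⟧ φ (a ++ b))))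

infixr 6 _⊕ᴵ_
infixr 7 _·ᴵ_

data Ideal {n : ℕ} : FA n → Set where
  sandwich : (u : Word n) (r : Relator n) (v : Word n) → Ideal (⟦ u ⟧ ⊗ (relator r ⊗ ⟦ v ⟧))
  empty    : Ideal []
  _⊕ᴵ_     : {x y : FA n} → Ideal x → Ideal y → Ideal (x ⊕ y)
  _·ᴵ_     : {x : FA n} (c : ℚ) → Ideal x → Ideal (c · x)
  resp     : {x y : FA n} → x ≐ y → Ideal x → Ideal y

IdealTerm : ℕ → Set
IdealTerm n = ℚ × Word n × Relator n × Word n

termValue : (Word n → ℚ) → IdealTerm n → ℚ
termValue φ (q , u , r , v) = q * lin φ (⟦ u ⟧ ⊗ (relator r ⊗ ⟦ v ⟧))

scaleTerm : ℚ → IdealTerm n → IdealTerm n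
scaleTerm c (q , t) = (c * q , t)

witness : {x : FA n} → Ideal x → List (IdealTerm n)
witness (sandwich u r v) = (1ℚ , u , r , v) ∷ []
witness empty = []
witness (p ⊕ᴵ q) = witness p ++ witness q
witness (c ·ᴵ p) = map (scaleTerm c) (witness p)
witness (resp _ p) = witness p

lin-witness : (φ : Word n → ℚ) {x : FA n} (p : Ideal x) → lin φ x ≡ ∑[ t ∈ witness p ] termValue φ t
lin-witness φ (sandwich u r v) = sym (trans (+-identityʳ _) (*-identityˡ _))
lin-witness φ empty = refl
lin-witness φ (_⊕ᴵ_ {x} {y} p q) = begin
  lin φ (x ⊕ y)                                     ≡⟨ lin-⊕ φ x y ⟩
  lin φ x + lin φ y                                 ≡⟨ cong₂ _+_ (lin-witness φ p) (lin-witness φ q) ⟩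
  ∑ (witness p) (termValue φ) + ∑ (witness q) (termValue φ) ≡⟨ sym (∑-++ (witness p) (witness q) _) ⟩
  ∑ (witness p ++ witness q) (termValue φ)          ∎
lin-witness φ (_·ᴵ_ {x} c p) = begin
  lin φ (c · x)                                     ≡⟨ lin-· φ c x ⟩
  c * lin φ x                                       ≡⟨ cong (c *_) (lin-witness φ p) ⟩
  c * ∑ (witness p) (termValue φ)                   ≡⟨ sym (∑-*ˡ c (witness p) _) ⟩
  ∑[ t ∈ witness p ] (c * termValue φ t)            ≡⟨ ∑-cong (witness p) (λ t → sym (*-assoc c (proj₁ t) _)) ⟩
  ∑[ t ∈ witness p ] termValue φ (scaleTerm c t)    ≡⟨ sym (∑-map (scaleTerm c) (witness p) _) ⟩
  ∑ (map (scaleTerm c) (witness p)) (termValue φ)   ∎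
lin-witness φ (resp x≐y p) = trans (sym (lin-≡ x≐y φ)) (lin-witness φ p)

lin-sumFA-terms : {F : IdealTerm n → FA n} →
  (∀ q u r v → F (q , u , r , v) ≡ q · (⟦ u ⟧ ⊗ (relator r ⊗ ⟦ v ⟧))) →
  (φ : Word n → ℚ) (L : List (IdealTerm n)) → lin φ (sumFA (map F L)) ≡ ∑[ t ∈ L ] termValue φ t
lin-sumFA-terms {F = F} F-term φ L = begin
  lin φ (sumFA (map F L))       ≡⟨ lin-sumFA φ (map F L) ⟩
  ∑ (map F L) (lin φ)           ≡⟨ ∑-map F L (lin φ) ⟩
  ∑[ t ∈ L ] lin φ (F t)        ≡⟨ ∑-cong L (λ (q , u , r , v) →
                                     trans (cong (lin φ) (F-term q u r v)) (lin-· φ q (⟦ u ⟧ ⊗ (relator r ⊗ ⟦ v ⟧)))) ⟩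
  ∑[ t ∈ L ] termValue φ t      ∎

-- InIdeal maps its terms through a pattern lambda of Defs; quantifying over any F that
-- agrees with it lets Ideal⇒InIdeal supply it by unification.
witness-≋ : {F : IdealTerm n → FA n} →
  (∀ q u r v → F (q , u , r , v) ≡ q · (⟦ u ⟧ ⊗ (relator r ⊗ ⟦ v ⟧))) →
  {x : FA n} (p : Ideal x) → x ≋ sumFA (map F (witness p))
witness-≋ {F = F} F-term {x} p = ≐⇒≋ {x = x} {y = sumFA (map F (witness p))} (mk≐ λ φ →
  trans (lin-witness φ p) (sym (lin-sumFA-terms F-term φ (witness p))))

Ideal⇒InIdeal : {x : FA n} → Ideal x → InIdeal x
Ideal⇒InIdeal p = witness p , witness-≋ (λ _ _ _ _ → refl) p

Ideal-⟦⟧⊗ : (w : Word n) {x : FA n} → Ideal x → Ideal (⟦ w ⟧ ⊗ x)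
Ideal-⟦⟧⊗ w (sandwich u r v) = resp shift (sandwich (w ++ u) r v)
  where
  shift : ⟦ w ++ u ⟧ ⊗ (relator r ⊗ ⟦ v ⟧) ≐ ⟦ w ⟧ ⊗ (⟦ u ⟧ ⊗ (relator r ⊗ ⟦ v ⟧))
  shift = mk≐ λ φ → begin
    lin φ (⟦ w ++ u ⟧ ⊗ (relator r ⊗ ⟦ v ⟧))       ≡⟨ lin-sandwich φ (w ++ u) (relator r) v ⟩
    lin (λ b → φ ((w ++ u) ++ b ++ v)) (relator r) ≡⟨ lin-cong (λ b → cong φ (Listₚ.++-assoc w u (b ++ v))) (relator r) ⟩
    lin (λ b → φ (w ++ u ++ b ++ v)) (relator r)   ≡⟨ sym (lin-sandwich (λ a → φ (w ++ a)) u (relator r) v) ⟩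
    lin (λ a → φ (w ++ a)) (⟦ u ⟧ ⊗ (relator r ⊗ ⟦ v ⟧))  ≡⟨ sym (lin-⟦⟧⊗ φ w (⟦ u ⟧ ⊗ (relator r ⊗ ⟦ v ⟧))) ⟩
    lin φ (⟦ w ⟧ ⊗ (⟦ u ⟧ ⊗ (relator r ⊗ ⟦ v ⟧)))  ∎
Ideal-⟦⟧⊗ w empty = empty
Ideal-⟦⟧⊗ w (_⊕ᴵ_ {x} {y} p q) = resp (≐-sym (⊗-distribˡ-⊕ ⟦ w ⟧ x y)) (Ideal-⟦⟧⊗ w p ⊕ᴵ Ideal-⟦⟧⊗ w q)
Ideal-⟦⟧⊗ w (_·ᴵ_ {x} c p) = resp (≐-sym (⊗-·ʳ c ⟦ w ⟧ x)) (c ·ᴵ Ideal-⟦⟧⊗ w p)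
Ideal-⟦⟧⊗ w (resp x≐y p) = resp (⊗-congʳ ⟦ w ⟧ x≐y) (Ideal-⟦⟧⊗ w p)

Ideal-⊗⟦⟧ : {x : FA n} → Ideal x → (w : Word n) → Ideal (x ⊗ ⟦ w ⟧)
Ideal-⊗⟦⟧ (sandwich u r v) w = resp shift (sandwich u r (v ++ w))
  where
  shift : ⟦ u ⟧ ⊗ (relator r ⊗ ⟦ v ++ w ⟧) ≐ (⟦ u ⟧ ⊗ (relator r ⊗ ⟦ v ⟧)) ⊗ ⟦ w ⟧
  shift = mk≐ λ φ → begin
    lin φ (⟦ u ⟧ ⊗ (relator r ⊗ ⟦ v ++ w ⟧))          ≡⟨ lin-sandwich φ u (relator r) (v ++ w) ⟩
    lin (λ b → φ (u ++ b ++ v ++ w)) (relator r)     ≡⟨ lin-cong (λ b → cong φ (reassoc b)) (relator r) ⟩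
    lin (λ b → φ ((u ++ b ++ v) ++ w)) (relator r)   ≡⟨ sym (lin-sandwich (λ a → φ (a ++ w)) u (relator r) v) ⟩
    lin (λ a → φ (a ++ w)) (⟦ u ⟧ ⊗ (relator r ⊗ ⟦ v ⟧)) ≡⟨ sym (lin-⊗⟦⟧ φ (⟦ u ⟧ ⊗ (relator r ⊗ ⟦ v ⟧)) w) ⟩
    lin φ ((⟦ u ⟧ ⊗ (relator r ⊗ ⟦ v ⟧)) ⊗ ⟦ w ⟧)     ∎
    where
    reassoc : ∀ b → u ++ b ++ v ++ w ≡ (u ++ b ++ v) ++ w
    reassoc b = sym (trans (Listₚ.++-assoc u (b ++ v) w) (cong (u ++_) (Listₚ.++-assoc b v w)))
Ideal-⊗⟦⟧ empty w = empty
Ideal-⊗⟦⟧ (_⊕ᴵ_ {x} {y} p q) w = resp (≐-sym (⊗-distribʳ-⊕ x y ⟦ w ⟧)) (Ideal-⊗⟦⟧ p w ⊕ᴵ Ideal-⊗⟦⟧ q w)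
Ideal-⊗⟦⟧ (_·ᴵ_ {x} c p) w = resp (≐-sym (⊗-·ˡ c x ⟦ w ⟧)) (c ·ᴵ Ideal-⊗⟦⟧ p w)
Ideal-⊗⟦⟧ (resp x≐y p) w = resp (⊗-congˡ ⟦ w ⟧ x≐y) (Ideal-⊗⟦⟧ p w)

Ideal-⊗ˡ : (y : FA n) {x : FA n} → Ideal x → Ideal (y ⊗ x)
Ideal-⊗ˡ [] p = empty
Ideal-⊗ˡ ((q , w) ∷ y) {x} p = resp (≐-sym (⊗-consˡ q w y x)) (q ·ᴵ Ideal-⟦⟧⊗ w p ⊕ᴵ Ideal-⊗ˡ y p)

Ideal-⊗ʳ : {x : FA n} → Ideal x → (y : FA n) → Ideal (x ⊗ y)
Ideal-⊗ʳ {x = x} p [] = resp (≐-sym (⊗-zeroʳ x)) empty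
Ideal-⊗ʳ {x = x} p ((q , w) ∷ y) = resp (≐-sym (⊗-consʳ q w x y)) (q ·ᴵ Ideal-⊗⟦⟧ p w ⊕ᴵ Ideal-⊗ʳ p y)

relator-Ideal : (r : Relator n) → Ideal (relator r)
relator-Ideal r = resp (mk≐ λ φ → trans (lin-sandwich φ [] (relator r) [])
                                        (lin-cong {φ = λ b → φ (b ++ [])} (λ b → cong φ (Listₚ.++-identityʳ b)) (relator r)))
                       (sandwich [] r [])

-- ℕ→ℚ normalises through _/_, so we invert its coprime form, whose NonZero instance is found.
Ideal-cancel : (k : ℕ) {x : FA n} → Ideal (ℕ→ℚ (suc k) · x) → Ideal x
Ideal-cancel k {x} p = resp (mk≐ λ φ → begin
  lin φ (q⁻¹ · (ℕ→ℚ (suc k) · x))      ≡⟨ trans (lin-· φ q⁻¹ (ℕ→ℚ (suc k) · x)) (cong (q⁻¹ *_) (lin-· φ (ℕ→ℚ (suc k)) x)) ⟩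
  q⁻¹ * (ℕ→ℚ (suc k) * lin φ x)        ≡⟨ sym (*-assoc q⁻¹ (ℕ→ℚ (suc k)) (lin φ x)) ⟩
  q⁻¹ * ℕ→ℚ (suc k) * lin φ x          ≡⟨ cong (λ c → q⁻¹ * c * lin φ x) (ℕ→ℚ-mkℚ (suc k)) ⟩
  q⁻¹ * q * lin φ x                    ≡⟨ cong (_* lin φ x) (*-inverseˡ q) ⟩
  1ℚ * lin φ x                         ≡⟨ *-identityˡ (lin φ x) ⟩
  lin φ x                              ∎) (q⁻¹ ·ᴵ p)
  where
  q = mkℚ (ℤ.+ suc k) 0 (Coprime.sym (1-coprimeTo (suc k)))
  q⁻¹ = ℚ.1/ q

infix 4 _≈_

record _≈_ (x y : FA n) : Set where
  constructor mk≈
  field difference : Ideal (x ⊕ (⊖ y))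
open _≈_ public

≐⇒≈ : {x y : FA n} → x ≐ y → x ≈ y
≐⇒≈ {x = x} {y} x≐y = mk≈ (resp (mk≐ λ φ → sym (begin
  lin φ (x ⊕ (⊖ y))     ≡⟨ lin-⊕⊖ φ x y ⟩
  lin φ x + - lin φ y   ≡⟨ cong (_+ - lin φ y) (lin-≡ x≐y φ) ⟩
  lin φ y + - lin φ y   ≡⟨ +-inverseʳ (lin φ y) ⟩
  0ℚ                    ∎)) empty)

≈-refl : {x : FA n} → x ≈ x
≈-refl = ≐⇒≈ (mk≐ λ φ → refl)

≈-sym : {x y : FA n} → x ≈ y → y ≈ x
≈-sym {x = x} {y} x≈y = mk≈ (resp (mk≐ λ φ → begin
  lin φ ((- 1ℚ) · (x ⊕ (⊖ y)))   ≡⟨ trans (lin-· φ (- 1ℚ) (x ⊕ (⊖ y))) (cong (- 1ℚ *_) (lin-⊕⊖ φ x y)) ⟩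
  - 1ℚ * (lin φ x + - lin φ y)    ≡⟨ negate (lin φ x) (lin φ y) ⟩
  lin φ y + - lin φ x            ≡⟨ sym (lin-⊕⊖ φ y x) ⟩
  lin φ (y ⊕ (⊖ x))              ∎) ((- 1ℚ) ·ᴵ difference x≈y))
  where
  negate : ∀ a b → - 1ℚ * (a + - b) ≡ b + - a
  negate = solve-∀ ℚ-ring

≈-trans : {x y z : FA n} → x ≈ y → y ≈ z → x ≈ z
≈-trans {x = x} {y} {z} x≈y y≈z = mk≈ (resp (mk≐ λ φ → begin
  lin φ ((x ⊕ (⊖ y)) ⊕ (y ⊕ (⊖ z)))               ≡⟨ trans (lin-⊕ φ (x ⊕ (⊖ y)) (y ⊕ (⊖ z))) (cong₂ _+_ (lin-⊕⊖ φ x y) (lin-⊕⊖ φ y z)) ⟩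
  (lin φ x + - lin φ y) + (lin φ y + - lin φ z)  ≡⟨ telescope (lin φ x) (lin φ y) (lin φ z) ⟩
  lin φ x + - lin φ z                            ≡⟨ sym (lin-⊕⊖ φ x z) ⟩
  lin φ (x ⊕ (⊖ z))                              ∎) (difference x≈y ⊕ᴵ difference y≈z))
  where
  telescope : ∀ a b c → (a + - b) + (b + - c) ≡ a + - c
  telescope = solve-∀ ℚ-ring

⊕-cong≈ : {x x' y y' : FA n} → x ≈ x' → y ≈ y' → x ⊕ y ≈ x' ⊕ y'
⊕-cong≈ {x = x} {x'} {y} {y'} x≈x' y≈y' = mk≈ (resp (mk≐ λ φ → begin
  lin φ ((x ⊕ (⊖ x')) ⊕ (y ⊕ (⊖ y')))              ≡⟨ trans (lin-⊕ φ (x ⊕ (⊖ x')) (y ⊕ (⊖ y'))) (cong₂ _+_ (lin-⊕⊖ φ x x') (lin-⊕⊖ φ y y')) ⟩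
  (lin φ x + - lin φ x') + (lin φ y + - lin φ y') ≡⟨ regroup (lin φ x) (lin φ x') (lin φ y) (lin φ y') ⟩
  (lin φ x + lin φ y) + - (lin φ x' + lin φ y')   ≡⟨ sym (trans (lin-⊕⊖ φ (x ⊕ y) (x' ⊕ y'))
                                                      (cong₂ (λ a b → a + - b) (lin-⊕ φ x y) (lin-⊕ φ x' y'))) ⟩
  lin φ ((x ⊕ y) ⊕ (⊖ (x' ⊕ y')))                 ∎) (difference x≈x' ⊕ᴵ difference y≈y'))
  where
  regroup : ∀ a b c d → (a + - b) + (c + - d) ≡ (a + c) + - (b + d)
  regroup = solve-∀ ℚ-ring

·-cong≈ : (c : ℚ) {x y : FA n} → x ≈ y → c · x ≈ c · y
·-cong≈ c {x} {y} x≈y = mk≈ (resp (mk≐ λ φ → begin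
  lin φ (c · (x ⊕ (⊖ y)))              ≡⟨ trans (lin-· φ c (x ⊕ (⊖ y))) (cong (c *_) (lin-⊕⊖ φ x y)) ⟩
  c * (lin φ x + - lin φ y)            ≡⟨ distrib c (lin φ x) (lin φ y) ⟩
  c * lin φ x + - (c * lin φ y)        ≡⟨ sym (trans (lin-⊕⊖ φ (c · x) (c · y)) (cong₂ (λ a b → a + - b) (lin-· φ c x) (lin-· φ c y))) ⟩
  lin φ ((c · x) ⊕ (⊖ (c · y)))        ∎) (c ·ᴵ difference x≈y))
  where
  distrib : ∀ c a b → c * (a + - b) ≡ c * a + - (c * b)
  distrib = solve-∀ ℚ-ring

⊗-congˡ≈ : {x x' : FA n} (y : FA n) → x ≈ x' → x ⊗ y ≈ x' ⊗ y
⊗-congˡ≈ {x = x} {x'} y x≈x' = mk≈ (resp distrib (Ideal-⊗ʳ (difference x≈x') y))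
  where
  distrib : (x ⊕ (⊖ x')) ⊗ y ≐ (x ⊗ y) ⊕ (⊖ (x' ⊗ y))
  distrib = ≐-trans (⊗-distribʳ-⊕ x (⊖ x') y) (⊕-congʳ (x ⊗ y) (⊗-·ˡ (- 1ℚ) x' y))

⊗-congʳ≈ : (x : FA n) {y y' : FA n} → y ≈ y' → x ⊗ y ≈ x ⊗ y'
⊗-congʳ≈ x {y} {y'} y≈y' = mk≈ (resp distrib (Ideal-⊗ˡ x (difference y≈y')))
  where
  distrib : x ⊗ (y ⊕ (⊖ y')) ≐ (x ⊗ y) ⊕ (⊖ (x ⊗ y'))
  distrib = ≐-trans (⊗-distribˡ-⊕ x y (⊖ y')) (⊕-congʳ (x ⊗ y) (⊗-·ʳ (- 1ℚ) x y'))

Ideal⇒≈[] : {x : FA n} → Ideal x → x ≈ []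
Ideal⇒≈[] {x = x} p = mk≈ (resp (mk≐ λ φ → sym (trans (lin-⊕ φ x []) (+-identityʳ (lin φ x)))) p)

≈[]⇒Ideal : {x : FA n} → x ≈ [] → Ideal x
≈[]⇒Ideal {x = x} x≈[] = resp (mk≐ λ φ → trans (lin-⊕ φ x []) (+-identityʳ (lin φ x))) (difference x≈[])

-- Monomials of degree greater than n vanish

lin-anti : (ψ : Word n → ℚ) (g h : Gen n) → lin ψ (relator (anti g h)) ≡ ψ (g ∷ h ∷ []) + ψ (h ∷ g ∷ [])
lin-anti ψ g h = trans (lin-⊕ ψ (gen g ⊗ gen h) (gen h ⊗ gen g)) (cong₂ _+_ (lin-gen⊗gen ψ g h) (lin-gen⊗gen ψ h g))

lin-os : (ψ : Word n → ℚ) (i j k : Fin (suc n)) (i<j : i Fin.< j) (j<k : j Fin.< k) →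
         let ij = (i , j , i<j); jk = (j , k , j<k); ik = (i , k , Finₚ.<-trans i<j j<k) in
         lin ψ (relator (os i j k i<j j<k)) ≡ ψ (ik ∷ jk ∷ []) + (- ψ (ij ∷ jk ∷ []) + ψ (ij ∷ ik ∷ []))
lin-os ψ i j k i<j j<k =
  trans (lin-⊕ ψ (gen ik ⊗ gen jk) ((⊖ (gen ij ⊗ gen jk)) ⊕ (gen ij ⊗ gen ik))) (cong₂ _+_ (lin-gen⊗gen ψ ik jk)
    (trans (lin-⊕ ψ (⊖ (gen ij ⊗ gen jk)) (gen ij ⊗ gen ik))
      (cong₂ _+_ (trans (lin-⊖ ψ (gen ij ⊗ gen jk)) (cong -_ (lin-gen⊗gen ψ ij jk))) (lin-gen⊗gen ψ ij ik))))
  where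
  ij jk ik : Gen _
  ij = i , j , i<j
  jk = j , k , j<k
  ik = i , k , Finₚ.<-trans i<j j<k

anticomm : (u : Word n) (g h : Gen n) (z : Word n) → ⟦ u ++ g ∷ h ∷ z ⟧ ≈ ⊖ ⟦ u ++ h ∷ g ∷ z ⟧
anticomm u g h z = mk≈ (resp (mk≐ λ φ → begin
  lin φ (⟦ u ⟧ ⊗ (relator (anti g h) ⊗ ⟦ z ⟧))
    ≡⟨ lin-sandwich φ u (relator (anti g h)) z ⟩
  lin (λ b → φ (u ++ b ++ z)) (relator (anti g h))
    ≡⟨ lin-anti (λ b → φ (u ++ b ++ z)) g h ⟩
  φ (u ++ g ∷ h ∷ z) + φ (u ++ h ∷ g ∷ z)
    ≡⟨ double-negation (φ (u ++ g ∷ h ∷ z)) (φ (u ++ h ∷ g ∷ z)) ⟩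
  φ (u ++ g ∷ h ∷ z) + - (- φ (u ++ h ∷ g ∷ z))
    ≡⟨ cong₂ (λ a b → a + - b) (sym (lin-⟦⟧ φ _)) (sym (trans (lin-⊖ φ ⟦ u ++ h ∷ g ∷ z ⟧) (cong -_ (lin-⟦⟧ φ _)))) ⟩
  lin φ ⟦ u ++ g ∷ h ∷ z ⟧ + - lin φ (⊖ ⟦ u ++ h ∷ g ∷ z ⟧)
    ≡⟨ sym (lin-⊕⊖ φ ⟦ u ++ g ∷ h ∷ z ⟧ (⊖ ⟦ u ++ h ∷ g ∷ z ⟧)) ⟩
  lin φ (⟦ u ++ g ∷ h ∷ z ⟧ ⊕ (⊖ (⊖ ⟦ u ++ h ∷ g ∷ z ⟧))) ∎) (sandwich u (anti g h) z))
  where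
  double-negation : ∀ a b → a + b ≡ a + - (- b)
  double-negation = solve-∀ ℚ-ring

Ideal-swap : (u : Word n) (g h : Gen n) (z : Word n) → Ideal ⟦ u ++ h ∷ g ∷ z ⟧ → Ideal ⟦ u ++ g ∷ h ∷ z ⟧
Ideal-swap u g h z p = ≈[]⇒Ideal (≈-trans (anticomm u g h z) (·-cong≈ (- 1ℚ) (Ideal⇒≈[] p)))

Ideal-square : (u : Word n) (g : Gen n) (z : Word n) → Ideal ⟦ u ++ g ∷ g ∷ z ⟧
Ideal-square u g z = resp (mk≐ λ φ → begin
  lin φ (⟦ u ⟧ ⊗ (relator (square g) ⊗ ⟦ z ⟧)) ≡⟨ lin-sandwich φ u (relator (square g)) z ⟩
  lin (λ b → φ (u ++ b ++ z)) (gen g ⊗ gen g)  ≡⟨ lin-gen⊗gen (λ b → φ (u ++ b ++ z)) g g ⟩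
  φ (u ++ g ∷ g ∷ z)                           ≡⟨ sym (lin-⟦⟧ φ (u ++ g ∷ g ∷ z)) ⟩
  lin φ ⟦ u ++ g ∷ g ∷ z ⟧                     ∎) (sandwich u (square g) z)

Ideal-os : (u : Word n) (i j k : Fin (suc n)) (i<j : i Fin.< j) (j<k : j Fin.< k) (i<k : i Fin.< k) (z : Word n) →
           Ideal ⟦ u ++ (i , j , i<j) ∷ (j , k , j<k) ∷ z ⟧ → Ideal ⟦ u ++ (i , j , i<j) ∷ (i , k , i<k) ∷ z ⟧ →
           Ideal ⟦ u ++ (i , k , i<k) ∷ (j , k , j<k) ∷ z ⟧
Ideal-os u i j k i<j j<k i<k z p q rewrite Finₚ.<-irrelevant i<k (Finₚ.<-trans i<j j<k) =
  resp (mk≐ λ φ → begin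
    lin φ ((⟦ u ⟧ ⊗ (R ⊗ ⟦ z ⟧)) ⊕ (⟦ u ++ ij ∷ jk ∷ z ⟧ ⊕ (⊖ ⟦ u ++ ij ∷ ik ∷ z ⟧)))
      ≡⟨ lin-⊕ φ (⟦ u ⟧ ⊗ (R ⊗ ⟦ z ⟧)) (⟦ u ++ ij ∷ jk ∷ z ⟧ ⊕ (⊖ ⟦ u ++ ij ∷ ik ∷ z ⟧)) ⟩
    lin φ (⟦ u ⟧ ⊗ (R ⊗ ⟦ z ⟧)) + lin φ (⟦ u ++ ij ∷ jk ∷ z ⟧ ⊕ (⊖ ⟦ u ++ ij ∷ ik ∷ z ⟧))
      ≡⟨ cong₂ _+_ (trans (lin-sandwich φ u R z) (lin-os (λ b → φ (u ++ b ++ z)) i j k i<j j<k))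
                   (trans (lin-⊕⊖ φ ⟦ u ++ ij ∷ jk ∷ z ⟧ ⟦ u ++ ij ∷ ik ∷ z ⟧)
                          (cong₂ (λ a b → a + - b) (lin-⟦⟧ φ (u ++ ij ∷ jk ∷ z)) (lin-⟦⟧ φ (u ++ ij ∷ ik ∷ z)))) ⟩
    (φ (u ++ ik ∷ jk ∷ z) + (- φ (u ++ ij ∷ jk ∷ z) + φ (u ++ ij ∷ ik ∷ z))) + (φ (u ++ ij ∷ jk ∷ z) + - φ (u ++ ij ∷ ik ∷ z))
      ≡⟨ cancel (φ (u ++ ik ∷ jk ∷ z)) (φ (u ++ ij ∷ jk ∷ z)) (φ (u ++ ij ∷ ik ∷ z)) ⟩
    φ (u ++ ik ∷ jk ∷ z)
      ≡⟨ sym (lin-⟦⟧ φ (u ++ ik ∷ jk ∷ z)) ⟩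
    lin φ ⟦ u ++ ik ∷ jk ∷ z ⟧ ∎)
  (sandwich u (os i j k i<j j<k) z ⊕ᴵ p ⊕ᴵ (- 1ℚ) ·ᴵ q)
  where
  R = relator (os i j k i<j j<k)
  ij jk ik : Gen _
  ij = i , j , i<j
  jk = j , k , j<k
  ik = i , k , Finₚ.<-trans i<j j<k
  cancel : ∀ a b c → (a + (- b + c)) + (b + - c) ≡ a
  cancel = solve-∀ ℚ-ring

Ideal-↭ : (u : Word n) {xs ys : Word n} → xs ↭ ys → Ideal ⟦ u ++ xs ⟧ → Ideal ⟦ u ++ ys ⟧
Ideal-↭ u ↭.refl p = p
Ideal-↭ u (↭.prep g xs↭ys) p =
  subst (Ideal ∘ ⟦_⟧) (Listₚ.++-assoc u [ g ] _)
    (Ideal-↭ (u ++ [ g ]) xs↭ys (subst (Ideal ∘ ⟦_⟧) (sym (Listₚ.++-assoc u [ g ] _)) p))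
Ideal-↭ u (↭.swap g h xs↭ys) p =
  Ideal-swap u h g _ (subst (Ideal ∘ ⟦_⟧) (Listₚ.++-assoc u (g ∷ h ∷ []) _)
    (Ideal-↭ (u ++ g ∷ h ∷ []) xs↭ys (subst (Ideal ∘ ⟦_⟧) (sym (Listₚ.++-assoc u (g ∷ h ∷ []) _)) p)))
Ideal-↭ u (↭.trans xs↭ys ys↭zs) = Ideal-↭ u ys↭zs ∘ Ideal-↭ u xs↭ys

Ideal-adjacent : (u : Word n) (g h : Gen n) (z : Word n) → tgt g ≡ tgt h →
  (∀ a b → tgt a Fin.< tgt g → tgt b ≡ tgt h → Ideal ⟦ u ++ a ∷ b ∷ z ⟧) →
  Ideal ⟦ u ++ g ∷ h ∷ z ⟧
Ideal-adjacent u (i , k , i<k) (j , k , j<k) z refl lower with Finₚ.<-cmp i j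
... | tri< i<j _ _ = Ideal-os u i j k i<j j<k i<k z (lower _ _ j<k refl) (lower _ _ j<k refl)
... | tri≈ _ refl _ rewrite Finₚ.<-irrelevant i<k j<k = Ideal-square u (i , k , j<k) z
... | tri> _ _ j<i = Ideal-swap u _ _ z (Ideal-os u j i k j<i i<k j<k z (lower _ _ i<k refl) (lower _ _ i<k refl))

lookup-split : (xs : List A) (j : Fin (length xs)) → ∃[ v ] ∃[ z ] xs ≡ v ++ lookup xs j ∷ z
lookup-split (a ∷ xs) Fin.zero = [] , xs , refl
lookup-split (a ∷ xs) (Fin.suc j) with lookup-split xs j
... | v , z , eq = a ∷ v , z , cong (a ∷_) eq

lookup-split₂ : (xs : List A) (i j : Fin (length xs)) → i Fin.< j →
                ∃[ u ] ∃[ v ] ∃[ z ] xs ≡ u ++ lookup xs i ∷ v ++ lookup xs j ∷ z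
lookup-split₂ (a ∷ xs) Fin.zero (Fin.suc j) _ with lookup-split xs j
... | v , z , eq = [] , v , z , cong (a ∷_) eq
lookup-split₂ (a ∷ xs) (Fin.suc i) (Fin.suc j) (ℕ.s≤s i<j) with lookup-split₂ xs i j i<j
... | u , v , z , eq = a ∷ u , v , z , cong (a ∷_) eq

targetIndex : Gen n → Fin n
targetIndex (_ , Fin.zero , ())
targetIndex (_ , Fin.suc k , _) = k

targetIndex-injective : (g h : Gen n) → targetIndex g ≡ targetIndex h → tgt g ≡ tgt h
targetIndex-injective (_ , Fin.zero , ()) h
targetIndex-injective (_ , Fin.suc k , _) (_ , Fin.zero , ())
targetIndex-injective (_ , Fin.suc k , _) (_ , Fin.suc k' , _) k≡k' = cong Fin.suc k≡k'

repeated-target : (w : Word n) → n ℕ.< length w →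
  ∃[ u ] ∃[ g ] ∃[ v ] ∃[ h ] ∃[ z ] (w ≡ u ++ g ∷ v ++ h ∷ z × tgt g ≡ tgt h)
repeated-target w n<len with Finₚ.pigeonhole n<len (targetIndex ∘ lookup w)
... | i , j , i<j , same with lookup-split₂ w i j i<j
... | u , v , z , eq = u , lookup w i , v , lookup w j , z , eq , targetIndex-injective _ _ same

targetSum : Word n → ℕ
targetSum w = sum (map (toℕ ∘ tgt) w)

targetSum-++ : (u v : Word n) → targetSum (u ++ v) ≡ targetSum u ℕ.+ targetSum v
targetSum-++ u v = trans (cong sum (Listₚ.map-++ (toℕ ∘ tgt) u v)) (sum-++ (map (toℕ ∘ tgt) u) _)

targetSum-< : (u : Word n) (a b g h : Gen n) (z : Word n) → tgt a Fin.< tgt g → tgt b ≡ tgt h →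
              targetSum (u ++ a ∷ b ∷ z) ℕ.< targetSum (u ++ g ∷ h ∷ z)
targetSum-< u a b g h z a<g b≡h rewrite targetSum-++ u (a ∷ b ∷ z) | targetSum-++ u (g ∷ h ∷ z) =
  ℕₚ.+-monoʳ-< (targetSum u) (ℕₚ.+-mono-<-≤ a<g (ℕₚ.≤-reflexive (cong (λ k → toℕ k ℕ.+ targetSum z) b≡h)))

-- Induction on the sum of the targets, which the Orlik–Solomon relation lowers.
vanish-below : (m : ℕ) (w : Word n) → targetSum w ℕ.< m → n ℕ.< length w → Ideal ⟦ w ⟧
vanish-below (suc m) w ts<m n<len with repeated-target w n<len
... | u , g , v , h , z , refl , same = Ideal-↭ u perm (Ideal-adjacent u g h (v ++ z) same lower)
  where
  perm : g ∷ h ∷ v ++ z ↭ g ∷ v ++ h ∷ z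
  perm = ↭.prep g (↭.↭-sym (↭ₚ.shift h v z))
  lower : ∀ a b → tgt a Fin.< tgt g → tgt b ≡ tgt h → Ideal ⟦ u ++ a ∷ b ∷ v ++ z ⟧
  lower a b a<g b≡h = vanish-below m _
    (ℕₚ.<-≤-trans (targetSum-< u a b g h (v ++ z) a<g b≡h)
                  (ℕₚ.≤-trans (ℕₚ.≤-reflexive (sum-↭ (↭ₚ.map⁺ (toℕ ∘ tgt) (↭ₚ.++⁺ˡ u perm)))) (ℕₚ.≤-pred ts<m)))
    (ℕₚ.<-≤-trans n<len (ℕₚ.≤-reflexive (trans (sym (↭ₚ.↭-length (↭ₚ.++⁺ˡ u perm)))
                                               (trans (Listₚ.length-++ u) (sym (Listₚ.length-++ u))))))

word-vanishes : (w : Word n) → n ℕ.< length w → Ideal ⟦ w ⟧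
word-vanishes w = vanish-below (suc (targetSum w)) w ℕₚ.≤-refl

Homogeneous : ℕ → FA n → Set
Homogeneous d x = All (λ t → length (proj₂ t) ≡ d) x

relator-homogeneous : (r : Relator n) → Homogeneous 2 (relator r)
relator-homogeneous (square g) = refl ∷ []
relator-homogeneous (anti g h) = refl ∷ refl ∷ []
relator-homogeneous (os i j k i<j j<k) = refl ∷ refl ∷ refl ∷ []

Homogeneous-· : {d : ℕ} (c : ℚ) {x : FA n} → Homogeneous d x → Homogeneous d (c · x)
Homogeneous-· c hom = Allₚ.map⁺ hom

Homogeneous-⊗ : {d e : ℕ} {x y : FA n} → Homogeneous d x → Homogeneous e y → Homogeneous (d ℕ.+ e) (x ⊗ y)
Homogeneous-⊗ [] hy = []
Homogeneous-⊗ {x = (q , u) ∷ x} (len-u ∷ hx) hy =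
  Allₚ.++⁺ (Allₚ.map⁺ (All.map (λ len-v → trans (Listₚ.length-++ u) (cong₂ ℕ._+_ len-u len-v)) hy)) (Homogeneous-⊗ hx hy)

sumGens-homogeneous : (L : List (Gen n)) → Homogeneous 1 (sumFA (map gen L))
sumGens-homogeneous [] = []
sumGens-homogeneous (g ∷ L) = refl ∷ sumGens-homogeneous L

sumFA-homogeneous : {d : ℕ} (t : A → FA n) → (∀ a → Homogeneous d (t a)) → (L : List A) → Homogeneous d (sumFA (map t L))
sumFA-homogeneous t hom [] = []
sumFA-homogeneous t hom (a ∷ L) = Allₚ.++⁺ (hom a) (sumFA-homogeneous t hom L)

Homogeneous-^^ : {g : FA n} → Homogeneous 2 g → (k : ℕ) → Homogeneous (k ℕ.* 2) (g ^^ k)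
Homogeneous-^^ hom zero = refl ∷ []
Homogeneous-^^ {g = g} hom (suc k) = Homogeneous-⊗ {x = g} hom (Homogeneous-^^ hom k)

Homogeneous-vanishes : {d : ℕ} {x : FA n} → n ℕ.< d → Homogeneous d x → Ideal x
Homogeneous-vanishes n<d [] = empty
Homogeneous-vanishes {x = (q , w) ∷ x} n<d (refl ∷ hom) =
  resp (mk≐ λ φ → trans (lin-⊕ φ (q · ⟦ w ⟧) x) (cong (_+ lin φ x) (trans (lin-· φ q ⟦ w ⟧) (cong (q *_) (lin-⟦⟧ φ w)))))
       (q ·ᴵ word-vanishes w n<d ⊕ᴵ Homogeneous-vanishes n<d hom)

⟦⟧-comm₁₂ : (a b : Word n) → length a ≡ 1 → length b ≡ 2 → ⟦ a ++ b ⟧ ≈ ⟦ b ++ a ⟧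
⟦⟧-comm₁₂ (e ∷ []) (f ∷ h ∷ []) refl refl =
  ≈-trans (anticomm [] e f (h ∷ []))
    (≈-trans (·-cong≈ (- 1ℚ) (anticomm (f ∷ []) e h [])) (≐⇒≈ (⊖-involutive ⟦ f ∷ h ∷ e ∷ [] ⟧)))

⟦⟧-⊗-comm : {P Q : Word n → Set} → (∀ a b → P a → Q b → ⟦ a ++ b ⟧ ≈ ⟦ b ++ a ⟧) →
            (a : Word n) {y : FA n} → P a → All (Q ∘ proj₂) y → ⟦ a ⟧ ⊗ y ≈ y ⊗ ⟦ a ⟧
⟦⟧-⊗-comm comm a pa [] = ≈-refl
⟦⟧-⊗-comm comm a {(q , b) ∷ y} pa (qb ∷ qy) =
  ≈-trans (≐⇒≈ (⊗-consʳ q b ⟦ a ⟧ y))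
    (≈-trans (⊕-cong≈ (·-cong≈ q (≈-trans (≐⇒≈ (⟦⟧-⊗-⟦⟧ a b)) (≈-trans (comm a b pa qb) (≐⇒≈ (≐-sym (⟦⟧-⊗-⟦⟧ b a))))))
                      (⟦⟧-⊗-comm comm a pa qy))
      (≐⇒≈ (≐-sym (⊗-consˡ q b y ⟦ a ⟧))))

⊗-comm : {P Q : Word n → Set} → (∀ a b → P a → Q b → ⟦ a ++ b ⟧ ≈ ⟦ b ++ a ⟧) →
         {x y : FA n} → All (P ∘ proj₂) x → All (Q ∘ proj₂) y → x ⊗ y ≈ y ⊗ x
⊗-comm comm {y = y} [] qy = ≈-sym (≐⇒≈ (⊗-zeroʳ y))
⊗-comm comm {(q , a) ∷ x} {y} (pa ∷ px) qy =
  ≈-trans (≐⇒≈ (⊗-consˡ q a x y))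
    (≈-trans (⊕-cong≈ (·-cong≈ q (⟦⟧-⊗-comm comm a pa qy)) (⊗-comm comm px qy))
      (≐⇒≈ (≐-sym (⊗-consʳ q a y x))))

⊗-comm₁₂ : {x y : FA n} → Homogeneous 1 x → Homogeneous 2 y → x ⊗ y ≈ y ⊗ x
⊗-comm₁₂ = ⊗-comm ⟦⟧-comm₁₂

-- The boundary map

∂ʷ : Word n → FA n
∂ʷ [] = []
∂ʷ (g ∷ w) = ⟦ w ⟧ ⊕ (⊖ (gen g ⊗ ∂ʷ w))

∂ : FA n → FA n
∂ x = concatMap (λ t → proj₁ t · ∂ʷ (proj₂ t)) x

sign : Word n → ℚ
sign [] = 1ℚ
sign (g ∷ w) = - sign w

σ : FA n → FA n
σ x = map (λ t → (proj₁ t * sign (proj₂ t) , proj₂ t)) x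

lin-∂ : (φ : Word n → ℚ) (x : FA n) → lin φ (∂ x) ≡ lin (λ u → lin φ (∂ʷ u)) x
lin-∂ φ x = trans (∑-concatMap _ x _) (∑-cong x (λ t → lin-· φ (proj₁ t) (∂ʷ (proj₂ t))))

lin-σ : (φ : Word n → ℚ) (x : FA n) → lin φ (σ x) ≡ lin (λ u → sign u * φ u) x
lin-σ φ x = trans (∑-map _ x _) (∑-cong x (λ t → *-assoc (proj₁ t) _ _))

lin-∂ʷ-∷ : (φ : Word n → ℚ) (g : Gen n) (w : Word n) →
           lin φ (∂ʷ (g ∷ w)) ≡ φ w + - lin (λ b → φ (g ∷ b)) (∂ʷ w)
lin-∂ʷ-∷ φ g w = trans (lin-⊕⊖ φ ⟦ w ⟧ (gen g ⊗ ∂ʷ w))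
                       (cong₂ (λ a b → a + - b) (lin-⟦⟧ φ w) (lin-⟦⟧⊗ φ (g ∷ []) (∂ʷ w)))

lin-∂ʷ-++ : (φ : Word n → ℚ) (u v : Word n) →
  lin φ (∂ʷ (u ++ v)) ≡ lin (λ a → φ (a ++ v)) (∂ʷ u) + sign u * lin (λ b → φ (u ++ b)) (∂ʷ v)
lin-∂ʷ-++ φ [] v = sym (trans (+-identityˡ _) (*-identityˡ _))
lin-∂ʷ-++ φ (g ∷ u) v = begin
  lin φ (∂ʷ (g ∷ u ++ v))
    ≡⟨ lin-∂ʷ-∷ φ g (u ++ v) ⟩
  φ (u ++ v) + - lin (λ b → φ (g ∷ b)) (∂ʷ (u ++ v))
    ≡⟨ cong (λ c → φ (u ++ v) + - c) (lin-∂ʷ-++ (λ b → φ (g ∷ b)) u v) ⟩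
  φ (u ++ v) + - (lin (λ a → φ (g ∷ a ++ v)) (∂ʷ u) + sign u * lin (λ b → φ (g ∷ u ++ b)) (∂ʷ v))
    ≡⟨ regroup (φ (u ++ v)) _ (sign u) _ ⟩
  (φ (u ++ v) + - lin (λ a → φ (g ∷ a ++ v)) (∂ʷ u)) + - sign u * lin (λ b → φ (g ∷ u ++ b)) (∂ʷ v)
    ≡⟨ cong (_+ - sign u * lin (λ b → φ (g ∷ u ++ b)) (∂ʷ v)) (sym (lin-∂ʷ-∷ (λ a → φ (a ++ v)) g u)) ⟩
  lin (λ a → φ (a ++ v)) (∂ʷ (g ∷ u)) + - sign u * lin (λ b → φ (g ∷ u ++ b)) (∂ʷ v) ∎
  where
  regroup : ∀ a b s c → a + - (b + s * c) ≡ (a + - b) + - s * c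
  regroup = solve-∀ ℚ-ring

lin-∂ʷ₂ : (φ : Word n → ℚ) (g h : Gen n) → lin φ (∂ʷ (g ∷ h ∷ [])) ≡ φ (h ∷ []) + - φ (g ∷ [])
lin-∂ʷ₂ φ g h = begin
  lin φ (∂ʷ (g ∷ h ∷ []))                                 ≡⟨ lin-∂ʷ-∷ φ g (h ∷ []) ⟩
  φ (h ∷ []) + - lin (λ b → φ (g ∷ b)) (∂ʷ (h ∷ []))       ≡⟨ cong (λ c → φ (h ∷ []) + - c) (lin-∂ʷ-∷ (λ b → φ (g ∷ b)) h []) ⟩
  φ (h ∷ []) + - (φ (g ∷ []) + - 0ℚ)                      ≡⟨ drop-zero (φ (h ∷ [])) (φ (g ∷ [])) ⟩
  φ (h ∷ []) + - φ (g ∷ [])                               ∎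
  where
  drop-zero : ∀ a b → a + - (b + - 0ℚ) ≡ a + - b
  drop-zero = solve-∀ ℚ-ring

∂-cong : {x y : FA n} → x ≐ y → ∂ x ≐ ∂ y
∂-cong {x = x} {y} x≐y = mk≐ λ φ → trans (lin-∂ φ x) (trans (lin-≡ x≐y _) (sym (lin-∂ φ y)))

∂-⊕ : (x y : FA n) → ∂ (x ⊕ y) ≐ ∂ x ⊕ ∂ y
∂-⊕ x y = mk≐ λ φ →
  trans (lin-∂ φ (x ⊕ y)) (trans (lin-⊕ _ x y) (sym (trans (lin-⊕ φ (∂ x) (∂ y)) (cong₂ _+_ (lin-∂ φ x) (lin-∂ φ y)))))

∂-· : (c : ℚ) (x : FA n) → ∂ (c · x) ≐ c · ∂ x
∂-· c x = mk≐ λ φ →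
  trans (lin-∂ φ (c · x)) (trans (lin-· _ c x) (sym (trans (lin-· φ c (∂ x)) (cong (c *_) (lin-∂ φ x)))))

∂-⊗ : (x y : FA n) → ∂ (x ⊗ y) ≐ (∂ x ⊗ y) ⊕ (σ x ⊗ ∂ y)
∂-⊗ x y = mk≐ λ φ → begin
  lin φ (∂ (x ⊗ y))
    ≡⟨ trans (lin-∂ φ (x ⊗ y)) (lin-⊗ _ x y) ⟩
  lin (λ a → lin (λ b → lin φ (∂ʷ (a ++ b))) y) x
    ≡⟨ lin-cong (λ a → trans (lin-cong (λ b → lin-∂ʷ-++ φ a b) y) (lin-+ _ _ y)) x ⟩
  lin (λ a → lin (λ b → lin (λ c → φ (c ++ b)) (∂ʷ a)) y + lin (λ b → sign a * lin (λ c → φ (a ++ c)) (∂ʷ b)) y) x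
    ≡⟨ lin-+ _ _ x ⟩
  lin (λ a → lin (λ b → lin (λ c → φ (c ++ b)) (∂ʷ a)) y) x + lin (λ a → lin (λ b → sign a * lin (λ c → φ (a ++ c)) (∂ʷ b)) y) x
    ≡⟨ cong₂ _+_ (lin-cong (λ a → sym (lin-comm (λ c b → φ (c ++ b)) (∂ʷ a) y)) x)
                 (lin-cong (λ a → trans (lin-* (sign a) _ y) (cong (sign a *_) (sym (lin-∂ _ y)))) x) ⟩
  lin (λ a → lin (λ c → lin (λ b → φ (c ++ b)) y) (∂ʷ a)) x + lin (λ a → sign a * lin (λ c → φ (a ++ c)) (∂ y)) x
    ≡⟨ sym (cong₂ _+_ (trans (lin-⊗ φ (∂ x) y) (lin-∂ _ x)) (trans (lin-⊗ φ (σ x) (∂ y)) (lin-σ _ x))) ⟩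
  lin φ (∂ x ⊗ y) + lin φ (σ x ⊗ ∂ y)
    ≡⟨ sym (lin-⊕ φ (∂ x ⊗ y) (σ x ⊗ ∂ y)) ⟩
  lin φ ((∂ x ⊗ y) ⊕ (σ x ⊗ ∂ y)) ∎

sign-length₂ : (w : Word n) → length w ≡ 2 → sign w ≡ 1ℚ
sign-length₂ (a ∷ b ∷ []) refl = refl

σ-homogeneous₂ : {x : FA n} → Homogeneous 2 x → σ x ≐ x
σ-homogeneous₂ {x = x} hom = mk≐ λ φ → trans (lin-σ φ x) (∑-congᴬ hom λ (q , w) len≡2 →
  cong (q *_) (trans (cong (_* φ w) (sign-length₂ w len≡2)) (*-identityˡ (φ w))))

∂-even-⊗ : {g : FA n} → Homogeneous 2 g → (y : FA n) → ∂ (g ⊗ y) ≐ (∂ g ⊗ y) ⊕ (g ⊗ ∂ y)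
∂-even-⊗ {g = g} hom y = ≐-trans (∂-⊗ g y) (⊕-congʳ (∂ g ⊗ y) (⊗-congˡ (∂ y) (σ-homogeneous₂ hom)))

lin-∂-relator : (φ : Word n → ℚ) (r : Relator n) → lin (λ u → lin φ (∂ʷ u)) (relator r) ≡ 0ℚ
lin-∂-relator φ (square g) = trans (lin-gen⊗gen (λ u → lin φ (∂ʷ u)) g g) (trans (lin-∂ʷ₂ φ g g) (+-inverseʳ (φ (g ∷ []))))
lin-∂-relator φ (anti g h) =
  trans (lin-anti (λ u → lin φ (∂ʷ u)) g h) (trans (cong₂ _+_ (lin-∂ʷ₂ φ g h) (lin-∂ʷ₂ φ h g)) (cancel (φ (g ∷ [])) (φ (h ∷ []))))
  where
  cancel : ∀ a b → (b + - a) + (a + - b) ≡ 0ℚ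
  cancel = solve-∀ ℚ-ring
lin-∂-relator φ (os i j k i<j j<k) =
  trans (lin-os (λ u → lin φ (∂ʷ u)) i j k i<j j<k)
    (trans (cong₂ _+_ (lin-∂ʷ₂ φ ik jk) (cong₂ _+_ (cong -_ (lin-∂ʷ₂ φ ij jk)) (lin-∂ʷ₂ φ ij ik)))
      (cancel (φ (ij ∷ [])) (φ (jk ∷ [])) (φ (ik ∷ []))))
  where
  ij jk ik : Gen _
  ij = i , j , i<j
  jk = j , k , j<k
  ik = i , k , Finₚ.<-trans i<j j<k
  cancel : ∀ a b c → (b + - c) + (- (b + - a) + (c + - a)) ≡ 0ℚ
  cancel = solve-∀ ℚ-ring

∂-relator : (r : Relator n) → ∂ (relator r) ≐ []
∂-relator r = mk≐ λ φ → trans (lin-∂ φ (relator r)) (lin-∂-relator φ r)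

∂-relator-⊗ : (r : Relator n) (y : FA n) → ∂ (relator r ⊗ y) ≐ relator r ⊗ ∂ y
∂-relator-⊗ r y = ≐-trans (∂-⊗ (relator r) y)
  (⊕-cong (⊗-congˡ y (∂-relator r)) (⊗-congˡ (∂ y) (σ-homogeneous₂ (relator-homogeneous r))))

∂-Ideal : {x : FA n} → Ideal x → Ideal (∂ x)
∂-Ideal (sandwich u r v) = resp (≐-sym leibniz)
  (Ideal-⊗ˡ (∂ ⟦ u ⟧) (Ideal-⊗ʳ (relator-Ideal r) ⟦ v ⟧) ⊕ᴵ Ideal-⊗ˡ (σ ⟦ u ⟧) (Ideal-⊗ʳ (relator-Ideal r) (∂ ⟦ v ⟧)))
  where
  leibniz : ∂ (⟦ u ⟧ ⊗ (relator r ⊗ ⟦ v ⟧)) ≐ (∂ ⟦ u ⟧ ⊗ (relator r ⊗ ⟦ v ⟧)) ⊕ (σ ⟦ u ⟧ ⊗ (relator r ⊗ ∂ ⟦ v ⟧))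
  leibniz = ≐-trans (∂-⊗ ⟦ u ⟧ (relator r ⊗ ⟦ v ⟧)) (⊕-congʳ (∂ ⟦ u ⟧ ⊗ (relator r ⊗ ⟦ v ⟧)) (⊗-congʳ (σ ⟦ u ⟧) (∂-relator-⊗ r ⟦ v ⟧)))
∂-Ideal empty = empty
∂-Ideal (_⊕ᴵ_ {x} {y} p q) = resp (≐-sym (∂-⊕ x y)) (∂-Ideal p ⊕ᴵ ∂-Ideal q)
∂-Ideal (_·ᴵ_ {x} c p) = resp (≐-sym (∂-· c x)) (c ·ᴵ ∂-Ideal p)
∂-Ideal (resp x≐y p) = resp (∂-cong x≐y) (∂-Ideal p)

Homogeneous-∂ʷ : (g : Gen n) (w : Word n) → Homogeneous (length w) (∂ʷ (g ∷ w))
Homogeneous-∂ʷ g [] = refl ∷ []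
Homogeneous-∂ʷ g (h ∷ w) = refl ∷ Homogeneous-· (- 1ℚ) (Homogeneous-⊗ {x = gen g} (refl ∷ []) (Homogeneous-∂ʷ h w))

Homogeneous-∂ : {d : ℕ} {x : FA n} → Homogeneous (suc d) x → Homogeneous d (∂ x)
Homogeneous-∂ [] = []
Homogeneous-∂ {x = (q , g ∷ w) ∷ x} (refl ∷ hom) = Allₚ.++⁺ (Homogeneous-· q (Homogeneous-∂ʷ g w)) (Homogeneous-∂ hom)

∂-^^ : {g : FA n} → Homogeneous 2 g → (k : ℕ) → ∂ (g ^^ suc k) ≈ ℕ→ℚ (suc k) · (∂ g ⊗ (g ^^ k))
∂-^^ {g = g} hom zero = ≐⇒≈ (≐-trans (∂-even-⊗ hom (ι 1ℚ)) (mk≐ λ φ → begin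
  lin φ ((∂ g ⊗ ι 1ℚ) ⊕ (g ⊗ []))               ≡⟨ lin-⊕ φ (∂ g ⊗ ι 1ℚ) (g ⊗ []) ⟩
  lin φ (∂ g ⊗ ι 1ℚ) + lin φ (g ⊗ [])           ≡⟨ cong (lin φ (∂ g ⊗ ι 1ℚ) +_) (lin-≡ (⊗-zeroʳ g) φ) ⟩
  lin φ (∂ g ⊗ ι 1ℚ) + 0ℚ                       ≡⟨ trans (+-identityʳ (lin φ (∂ g ⊗ ι 1ℚ))) (sym (*-identityˡ (lin φ (∂ g ⊗ ι 1ℚ)))) ⟩
  1ℚ * lin φ (∂ g ⊗ ι 1ℚ)                       ≡⟨ sym (lin-· φ 1ℚ (∂ g ⊗ ι 1ℚ)) ⟩
  lin φ (1ℚ · (∂ g ⊗ ι 1ℚ))                     ∎))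
∂-^^ {g = g} hom (suc k) =
  ≈-trans (≐⇒≈ (∂-even-⊗ hom G)) (≈-trans (⊕-cong≈ (≈-refl {x = ∂ g ⊗ G}) g⊗∂G) (≐⇒≈ collect))
  where
  H = g ^^ k
  G = g ^^ suc k
  c = ℕ→ℚ (suc k)
  g⊗∂G : g ⊗ ∂ G ≈ c · (∂ g ⊗ G)
  g⊗∂G = ≈-trans (⊗-congʳ≈ g (∂-^^ hom k))
           (≈-trans (≐⇒≈ (≐-trans (⊗-·ʳ c g (∂ g ⊗ H)) (·-cong c (≐-sym (⊗-assoc g (∂ g) H)))))
             (≈-trans (·-cong≈ c (⊗-congˡ≈ H (≈-sym (⊗-comm₁₂ (Homogeneous-∂ hom) hom))))
               (≐⇒≈ (·-cong c (⊗-assoc (∂ g) g H)))))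
  collect : (∂ g ⊗ G) ⊕ (c · (∂ g ⊗ G)) ≐ ℕ→ℚ (suc (suc k)) · (∂ g ⊗ G)
  collect = mk≐ λ φ → begin
    lin φ ((∂ g ⊗ G) ⊕ (c · (∂ g ⊗ G)))          ≡⟨ trans (lin-⊕ φ (∂ g ⊗ G) _) (cong (lin φ (∂ g ⊗ G) +_) (lin-· φ c (∂ g ⊗ G))) ⟩
    lin φ (∂ g ⊗ G) + c * lin φ (∂ g ⊗ G)        ≡⟨ one-plus (lin φ (∂ g ⊗ G)) c ⟩
    (1ℚ + c) * lin φ (∂ g ⊗ G)                   ≡⟨ cong (_* lin φ (∂ g ⊗ G)) (sym (ℕ→ℚ-suc (suc k))) ⟩
    ℕ→ℚ (suc (suc k)) * lin φ (∂ g ⊗ G)          ≡⟨ sym (lin-· φ (ℕ→ℚ (suc (suc k))) (∂ g ⊗ G)) ⟩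
    lin φ (ℕ→ℚ (suc (suc k)) · (∂ g ⊗ G))        ∎
    where
    one-plus : ∀ a c → a + c * a ≡ (1ℚ + c) * a
    one-plus = solve-∀ ℚ-ring

-- Counting generators

-- gens is built from a helper local to Defs; these Σ-types name it by unification, so
-- that ∑-gens can case-split on the comparison i <? j inside it.
private
  gens-rows : Σ[ row ∈ (Fin (suc n) → List (Gen n)) ] gens n ≡ concatMap row (allFinL (suc n))
  gens-rows = _ , refl

  gens-cells : (i : Fin (suc n)) →
               Σ[ cell ∈ (Fin (suc n) → List (Gen n)) ] proj₁ gens-rows i ≡ concatMap cell (tabulate Fin.suc)
  gens-cells i = _ , refl

∑-gens : (f : Gen n → ℚ) (c : ℕ → ℕ → ℚ) → (∀ g → f g ≡ c (toℕ (src g)) (toℕ (tgt g))) →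
         ∑[ g ∈ gens n ] f g ≡ ∑[ j < suc n ] ∑[ i < j ] c i j
∑-gens {n} f c f≡c = begin
  ∑ (gens n) f
    ≡⟨ trans (cong (λ L → ∑ L f) (proj₂ gens-rows)) (∑-concatMap (proj₁ gens-rows) (allFinL (suc n)) f) ⟩
  ∑[ i ∈ allFinL (suc n) ] ∑ (proj₁ gens-rows i) f
    ≡⟨ ∑-cong (allFinL (suc n)) (λ i → trans (cong (λ L → ∑ L f) (proj₂ (gens-cells i))) (∑-concatMap (cell i) (tabulate {n = n} Fin.suc) f)) ⟩
  ∑[ i ∈ allFinL (suc n) ] ∑[ j ∈ tabulate {n = n} Fin.suc ] ∑ (cell i j) f
    ≡⟨ ∑-cong (allFinL (suc n)) (λ i → ∑-cong (tabulate {n = n} Fin.suc) (∑-cell i)) ⟩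
  ∑[ i ∈ allFinL (suc n) ] ∑[ j ∈ tabulate {n = n} Fin.suc ] when (toℕ i ℕ.<ᵇ toℕ j) (c (toℕ i) (toℕ j))
    ≡⟨ ∑-cong (allFinL (suc n)) (λ i → trans (∑-tabulate {m = n} Fin.suc suc (λ _ → refl) (λ j → when (toℕ i ℕ.<ᵇ j) (c (toℕ i) j)))
                                            (sym (+-identityˡ _))) ⟩
  ∑[ i ∈ allFinL (suc n) ] ∑[ j < suc n ] when (toℕ i ℕ.<ᵇ j) (c (toℕ i) j)
    ≡⟨ ∑-tabulate {m = suc n} (λ i → i) (λ i → i) (λ _ → refl) (λ i → ∑[ j < suc n ] when (i ℕ.<ᵇ j) (c i j)) ⟩
  ∑[ i < suc n ] ∑[ j < suc n ] when (i ℕ.<ᵇ j) (c i j)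
    ≡⟨ ∑-pairs (suc n) c ⟩
  ∑[ j < suc n ] ∑[ i < j ] c i j ∎
  where
  cell : Fin (suc n) → Fin (suc n) → List (Gen n)
  cell i = proj₁ (gens-cells i)
  ∑-cell : ∀ i j → ∑ (cell i j) f ≡ when (toℕ i ℕ.<ᵇ toℕ j) (c (toℕ i) (toℕ j))
  ∑-cell i j with i Fin.<? j
  ... | yes i<j = trans (+-identityʳ _) (trans (f≡c _) (sym (when-T _ (ℕₚ.<⇒<ᵇ i<j))))
  ... | no i≮j = sym (when-¬T _ (i≮j ∘ ℕₚ.<ᵇ⇒< _ _))

edgesA edgesM : (n : ℕ) → List (Gen n)
edgesA n = filterᵇ (λ g → notLast (tgt g)) (gens n)
edgesM n = filterᵇ (λ g → isLast (tgt g)) (gens n)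

edgesFrom : Fin (suc n) → List (Gen n)
edgesFrom {n} v = filterᵇ (λ h → isLast (tgt h) ∧ (toℕ (src h) ℕ.≡ᵇ toℕ v)) (gens n)

Gen-≡ : (g h : Gen n) → toℕ (src g) ≡ toℕ (src h) → toℕ (tgt g) ≡ toℕ (tgt h) → g ≡ h
Gen-≡ (i , j , i<j) (i' , j' , i'<j') i≡i' j≡j' with Finₚ.toℕ-injective i≡i' | Finₚ.toℕ-injective j≡j'
... | refl | refl = cong (λ p → (i , j , p)) (Finₚ.<-irrelevant i<j i'<j')

lastEdge : (v : ℕ) → v ℕ.< n → Gen n
lastEdge {n} v v<n = Fin.fromℕ< (ℕₚ.m<n⇒m<1+n v<n) , Fin.fromℕ n ,
  subst₂ ℕ._<_ (sym (Finₚ.toℕ-fromℕ< (ℕₚ.m<n⇒m<1+n v<n))) (sym (Finₚ.toℕ-fromℕ n)) v<n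

lastEdge-≡ : (v : ℕ) (v<n : v ℕ.< n) (h : Gen n) → toℕ (src h) ≡ v → toℕ (tgt h) ≡ n → lastEdge v v<n ≡ h
lastEdge-≡ {n} v v<n h src≡v tgt≡n =
  Gen-≡ (lastEdge v v<n) h (trans (Finₚ.toℕ-fromℕ< (ℕₚ.m<n⇒m<1+n v<n)) (sym src≡v)) (trans (Finₚ.toℕ-fromℕ n) (sym tgt≡n))

-- ψ at the generator from vertex v to the last vertex n, with junk value 0 when v ≥ n.
atLast : (Gen n → ℚ) → ℕ → ℚ
atLast {n} ψ v with v ℕ.<? n
... | yes v<n = ψ (lastEdge v v<n)
... | no _ = 0ℚ

atLast-lastEdge : (ψ : Gen n → ℚ) (v : ℕ) (v<n : v ℕ.< n) → atLast ψ v ≡ ψ (lastEdge v v<n)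
atLast-lastEdge {n} ψ v v<n with v ℕ.<? n
... | yes v<n' = cong (ψ ∘ lastEdge v) (ℕₚ.<-irrelevant v<n' v<n)
... | no v≮n = ⊥-elim (v≮n v<n)

∑-edgesM : (ψ : Gen n → ℚ) → ∑[ g ∈ edgesM n ] ψ g ≡ ∑[ v < n ] atLast ψ v
∑-edgesM {n} ψ = begin
  ∑[ g ∈ edgesM n ] ψ g
    ≡⟨ ∑-filterᵇ _ (gens n) ψ ⟩
  ∑[ g ∈ gens n ] when (isLast (tgt g)) (ψ g)
    ≡⟨ ∑-gens _ (λ i j → when (j ℕ.≡ᵇ n) (atLast ψ i)) on-last ⟩
  ∑[ j < suc n ] ∑[ i < j ] when (j ℕ.≡ᵇ n) (atLast ψ i)
    ≡⟨ ∑-last-column n (λ i _ → atLast ψ i) ⟩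
  ∑[ v < n ] atLast ψ v ∎
  where
  on-last : ∀ g → when (isLast (tgt g)) (ψ g) ≡ when (toℕ (tgt g) ℕ.≡ᵇ n) (atLast ψ (toℕ (src g)))
  on-last g with toℕ (tgt g) ℕ.≡ᵇ n in tgt≡n
  ... | false = refl
  ... | true = sym (trans (atLast-lastEdge ψ _ src<n) (cong ψ (lastEdge-≡ _ src<n g refl tgt≡n′)))
    where
    tgt≡n′ = ℕₚ.≡ᵇ⇒≡ (toℕ (tgt g)) n (subst T (sym tgt≡n) _)
    src<n = subst (toℕ (src g) ℕ.<_) tgt≡n′ (proj₂ (proj₂ g))

∑-edgesFrom : (ψ : Gen n → ℚ) (v : Fin (suc n)) (v<n : toℕ v ℕ.< n) →
              ∑[ h ∈ edgesFrom v ] ψ h ≡ ψ (lastEdge (toℕ v) v<n)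
∑-edgesFrom {n} ψ v v<n = begin
  ∑[ h ∈ edgesFrom v ] ψ h
    ≡⟨ ∑-filterᵇ _ (gens n) ψ ⟩
  ∑[ h ∈ gens n ] when (isLast (tgt h) ∧ (toℕ (src h) ℕ.≡ᵇ toℕ v)) (ψ h)
    ≡⟨ ∑-gens _ (λ i j → when (j ℕ.≡ᵇ n) (when (i ℕ.≡ᵇ toℕ v) y)) at-v ⟩
  ∑[ j < suc n ] ∑[ i < j ] when (j ℕ.≡ᵇ n) (when (i ℕ.≡ᵇ toℕ v) y)
    ≡⟨ ∑-last-column n (λ i _ → when (i ℕ.≡ᵇ toℕ v) y) ⟩
  ∑[ i < n ] when (i ℕ.≡ᵇ toℕ v) y
    ≡⟨ ∑-δ n (toℕ v) y v<n ⟩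
  y ∎
  where
  y = ψ (lastEdge (toℕ v) v<n)
  at-v : ∀ h → when (isLast (tgt h) ∧ (toℕ (src h) ℕ.≡ᵇ toℕ v)) (ψ h)
             ≡ when (toℕ (tgt h) ℕ.≡ᵇ n) (when (toℕ (src h) ℕ.≡ᵇ toℕ v) y)
  at-v h with toℕ (tgt h) ℕ.≡ᵇ n in tgt≡n | toℕ (src h) ℕ.≡ᵇ toℕ v in src≡v
  ... | false | _ = refl
  ... | true | false = refl
  ... | true | true = cong ψ (sym (lastEdge-≡ (toℕ v) v<n h
          (ℕₚ.≡ᵇ⇒≡ _ _ (subst T (sym src≡v) _)) (ℕₚ.≡ᵇ⇒≡ _ _ (subst T (sym tgt≡n) _))))

∑-edgesA : (X : ℕ → ℚ) → ∑[ g ∈ edgesA n ] (X (toℕ (src g)) + X (toℕ (tgt g))) ≡ (ℕ→ℚ n + - 1ℚ) * ∑[ v < n ] X v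
∑-edgesA {n} X = begin
  ∑[ g ∈ edgesA n ] (X (toℕ (src g)) + X (toℕ (tgt g)))
    ≡⟨ trans (∑-filterᵇ _ (gens n) _) (∑-gens {n = n} _ (λ i j → when (j ℕ.<ᵇ n) (X i + X j)) (λ _ → refl)) ⟩
  ∑[ j < suc n ] ∑[ i < j ] when (j ℕ.<ᵇ n) (X i + X j)
    ≡⟨ ∑<-suc n _ ⟩
  ∑[ j < n ] ∑[ i < j ] when (j ℕ.<ᵇ n) (X i + X j) + ∑[ i < n ] when (n ℕ.<ᵇ n) (X i + X n)
    ≡⟨ cong₂ _+_ (∑<-cong n (λ j j<n → ∑-cong (upTo j) (λ i → when-T (X i + X j) (ℕₚ.<⇒<ᵇ j<n))))
                 (trans (∑-cong (upTo n) (λ i → when-¬T (X i + X n) (ℕₚ.n≮n n ∘ ℕₚ.<ᵇ⇒< n n))) (∑-0 (upTo n))) ⟩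
  ∑[ j < n ] ∑[ i < j ] (X i + X j) + 0ℚ
    ≡⟨ trans (+-identityʳ _) (∑-triangle X n) ⟩
  (ℕ→ℚ n + - 1ℚ) * ∑[ v < n ] X v ∎

count-edgesM : count (edgesM n) ≡ ℕ→ℚ n
count-edgesM {n} = begin
  count (edgesM n)                    ≡⟨ ∑-edgesM {n = n} (λ _ → 1ℚ) ⟩
  ∑[ v < n ] atLast {n} (λ _ → 1ℚ) v   ≡⟨ ∑<-cong n (λ v v<n → atLast-lastEdge {n} (λ _ → 1ℚ) v v<n) ⟩
  count (upTo n)                      ≡⟨ count-upTo n ⟩
  ℕ→ℚ n                               ∎

count-edgesA : count (edgesA n) + count (edgesA n) ≡ (ℕ→ℚ n + - 1ℚ) * ℕ→ℚ n
count-edgesA {n} = begin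
  count (edgesA n) + count (edgesA n)         ≡⟨ sym (∑-+ (edgesA n) _ _) ⟩
  ∑[ g ∈ edgesA n ] (1ℚ + 1ℚ)                ≡⟨ ∑-edgesA {n = n} (λ _ → 1ℚ) ⟩
  (ℕ→ℚ n + - 1ℚ) * count (upTo n)             ≡⟨ cong ((ℕ→ℚ n + - 1ℚ) *_) (count-upTo n) ⟩
  (ℕ→ℚ n + - 1ℚ) * ℕ→ℚ n                      ∎

count-edgesA-odd : (k : ℕ) → let n = suc (k ℕ.* 2) in count (edgesA n) ≡ ℕ→ℚ k * (1ℚ + (ℕ→ℚ k + ℕ→ℚ k))
count-edgesA-odd k = double-injective _ _ (begin
  count (edgesA 2k+1) + count (edgesA 2k+1)   ≡⟨ count-edgesA {2k+1} ⟩
  (ℕ→ℚ 2k+1 + - 1ℚ) * ℕ→ℚ 2k+1               ≡⟨ cong (λ a → (a + - 1ℚ) * a) (ℕ→ℚ-odd k) ⟩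
  ((1ℚ + (K + K)) + - 1ℚ) * (1ℚ + (K + K))    ≡⟨ twice K ⟩
  K * (1ℚ + (K + K)) + K * (1ℚ + (K + K))     ∎)
  where
  2k+1 = suc (k ℕ.* 2)
  K = ℕ→ℚ k
  twice : ∀ k → ((1ℚ + (k + k)) + - 1ℚ) * (1ℚ + (k + k)) ≡ k * (1ℚ + (k + k)) + k * (1ℚ + (k + k))
  twice = solve-∀ ℚ-ring

lin-mOS : (φ : Word n → ℚ) → lin φ (mOS n) ≡ ∑[ v < n ] atLast (λ h → φ (h ∷ [])) v
lin-mOS {n} φ = trans (lin-sumGens φ (edgesM n)) (∑-edgesM (λ h → φ (h ∷ [])))

∂-aOS⊗mOS : ∂ (aOS n ⊗ mOS n) ≐ (count (edgesA n) · mOS n) ⊕ (⊖ (ℕ→ℚ n · aOS n))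
∂-aOS⊗mOS {n} = mk≐ λ φ → begin
  lin φ (∂ (aOS n ⊗ mOS n))
    ≡⟨ trans (lin-∂ φ (aOS n ⊗ mOS n)) (lin-⊗ _ (aOS n) (mOS n)) ⟩
  lin (λ u → lin (λ v → lin φ (∂ʷ (u ++ v))) (mOS n)) (aOS n)
    ≡⟨ trans (lin-sumGens _ (edgesA n)) (∑-cong (edgesA n) (λ g → lin-sumGens _ (edgesM n))) ⟩
  ∑[ g ∈ edgesA n ] ∑[ h ∈ edgesM n ] lin φ (∂ʷ (g ∷ h ∷ []))
    ≡⟨ ∑-cong (edgesA n) (λ g → ∑-cong (edgesM n) (λ h → lin-∂ʷ₂ φ g h)) ⟩
  ∑[ g ∈ edgesA n ] ∑[ h ∈ edgesM n ] (φ (h ∷ []) + - φ (g ∷ []))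
    ≡⟨ ∑∑-difference (edgesA n) (edgesM n) (λ h → φ (h ∷ [])) (λ g → φ (g ∷ [])) ⟩
  count (edgesA n) * ∑[ h ∈ edgesM n ] φ (h ∷ []) + - (count (edgesM n) * ∑[ g ∈ edgesA n ] φ (g ∷ []))
    ≡⟨ cong₂ (λ s t → count (edgesA n) * s + - t) (sym (lin-sumGens φ (edgesM n)))
             (cong₂ _*_ (count-edgesM {n}) (sym (lin-sumGens φ (edgesA n)))) ⟩
  count (edgesA n) * lin φ (mOS n) + - (ℕ→ℚ n * lin φ (aOS n))
    ≡⟨ sym (trans (lin-⊕⊖ φ (count (edgesA n) · mOS n) (ℕ→ℚ n · aOS n))
                   (cong₂ (λ s t → s + - t) (lin-· φ (count (edgesA n)) (mOS n)) (lin-· φ (ℕ→ℚ n) (aOS n)))) ⟩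
  lin φ ((count (edgesA n) · mOS n) ⊕ (⊖ (ℕ→ℚ n · aOS n))) ∎

lastFrom : Fin (suc n) → FA n
lastFrom v = sumFA (map gen (edgesFrom v))

lin-∂-gen⊗lastFrom : (φ : Word n → ℚ) (g : Gen n) (v : Fin (suc n)) → toℕ v ℕ.< n →
  lin φ (∂ (gen g ⊗ lastFrom v)) ≡ atLast (λ h → φ (h ∷ [])) (toℕ v) + - φ (g ∷ [])
lin-∂-gen⊗lastFrom {n} φ g v v<n = begin
  lin φ (∂ (gen g ⊗ lastFrom v))
    ≡⟨ trans (lin-∂ φ (gen g ⊗ lastFrom v)) (trans (lin-⟦⟧⊗ _ (g ∷ []) (lastFrom v)) (lin-sumGens _ (edgesFrom v))) ⟩
  ∑[ h ∈ edgesFrom v ] lin φ (∂ʷ (g ∷ h ∷ []))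
    ≡⟨ ∑-cong (edgesFrom v) (λ h → lin-∂ʷ₂ φ g h) ⟩
  ∑[ h ∈ edgesFrom v ] (φ (h ∷ []) + - φ (g ∷ []))
    ≡⟨ ∑-edgesFrom (λ h → φ (h ∷ []) + - φ (g ∷ [])) v v<n ⟩
  φ (lastEdge (toℕ v) v<n ∷ []) + - φ (g ∷ [])
    ≡⟨ cong (_+ - φ (g ∷ [])) (sym (atLast-lastEdge (λ h → φ (h ∷ [])) (toℕ v) v<n)) ⟩
  atLast (λ h → φ (h ∷ [])) (toℕ v) + - φ (g ∷ []) ∎

∂-cOS : ∂ (cOS n) ≐ ((ℕ→ℚ n + - 1ℚ) · mOS n) ⊕ (⊖ ((1ℚ + 1ℚ) · aOS n))
∂-cOS {n} = mk≐ λ φ → let X = atLast (λ h → φ (h ∷ [])) ; Φ = λ u → lin φ (∂ʷ u) in begin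
  lin φ (∂ (cOS n))
    ≡⟨ trans (lin-∂ φ (cOS n)) (trans (lin-sumFA Φ (map term (edgesA n))) (∑-map term (edgesA n) (lin Φ))) ⟩
  ∑[ g ∈ edgesA n ] lin Φ (term g)
    ≡⟨ ∑-filterᵇ-cong _ (gens n) (λ g g∈A → term-value φ g (ℕₚ.<ᵇ⇒< _ n g∈A)) ⟩
  ∑[ g ∈ edgesA n ] ((X (toℕ (src g)) + - φ (g ∷ [])) + (X (toℕ (tgt g)) + - φ (g ∷ [])))
    ≡⟨ trans (∑-cong (edgesA n) (λ g → regroup (X (toℕ (src g))) (X (toℕ (tgt g))) (φ (g ∷ [])))) (∑-+ (edgesA n) _ _) ⟩
  ∑[ g ∈ edgesA n ] (X (toℕ (src g)) + X (toℕ (tgt g))) + ∑[ g ∈ edgesA n ] (- (1ℚ + 1ℚ) * φ (g ∷ []))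
    ≡⟨ cong₂ _+_ (trans (∑-edgesA {n = n} X) (cong ((ℕ→ℚ n + - 1ℚ) *_) (sym (lin-mOS φ))))
                 (trans (∑-*ˡ (- (1ℚ + 1ℚ)) (edgesA n) _) (cong (- (1ℚ + 1ℚ) *_) (sym (lin-sumGens φ (edgesA n))))) ⟩
  (ℕ→ℚ n + - 1ℚ) * lin φ (mOS n) + - (1ℚ + 1ℚ) * lin φ (aOS n)
    ≡⟨ cong ((ℕ→ℚ n + - 1ℚ) * lin φ (mOS n) +_) (sym (neg-distribˡ-* (1ℚ + 1ℚ) (lin φ (aOS n)))) ⟩
  (ℕ→ℚ n + - 1ℚ) * lin φ (mOS n) + - ((1ℚ + 1ℚ) * lin φ (aOS n))
    ≡⟨ sym (trans (lin-⊕⊖ φ ((ℕ→ℚ n + - 1ℚ) · mOS n) ((1ℚ + 1ℚ) · aOS n))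
                  (cong₂ (λ s t → s + - t) (lin-· φ (ℕ→ℚ n + - 1ℚ) (mOS n)) (lin-· φ (1ℚ + 1ℚ) (aOS n)))) ⟩
  lin φ (((ℕ→ℚ n + - 1ℚ) · mOS n) ⊕ (⊖ ((1ℚ + 1ℚ) · aOS n))) ∎
  where
  term : Gen n → FA n
  term g = (gen g ⊗ lastFrom (src g)) ⊕ (gen g ⊗ lastFrom (tgt g))
  term-value : (φ : Word n → ℚ) (g : Gen n) → toℕ (tgt g) ℕ.< n →
    lin (λ u → lin φ (∂ʷ u)) (term g)
    ≡ (atLast (λ h → φ (h ∷ [])) (toℕ (src g)) + - φ (g ∷ [])) + (atLast (λ h → φ (h ∷ [])) (toℕ (tgt g)) + - φ (g ∷ []))
  term-value φ g tgt<n = trans (lin-⊕ _ (gen g ⊗ lastFrom (src g)) (gen g ⊗ lastFrom (tgt g)))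
    (cong₂ _+_ (trans (sym (lin-∂ φ (gen g ⊗ lastFrom (src g))))
                      (lin-∂-gen⊗lastFrom φ g (src g) (ℕₚ.<-trans (proj₂ (proj₂ g)) tgt<n)))
               (trans (sym (lin-∂ φ (gen g ⊗ lastFrom (tgt g)))) (lin-∂-gen⊗lastFrom φ g (tgt g) tgt<n)))
  regroup : ∀ a b y → (a + - y) + (b + - y) ≡ (a + b) + - (1ℚ + 1ℚ) * y
  regroup = solve-∀ ℚ-ring

gOS : (n p : ℕ) → FA n
gOS n p = (aOS n ⊗ mOS n) ⊕ (⊖ (ℕ→ℚ p · cOS n))

gOS-homogeneous : (p : ℕ) → Homogeneous 2 (gOS n p)
gOS-homogeneous {n} p = Allₚ.++⁺ (Homogeneous-⊗ {x = aOS n} (sumGens-homogeneous (edgesA n)) (sumGens-homogeneous (edgesM n)))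
                                  (Homogeneous-· (- 1ℚ) (Homogeneous-· (ℕ→ℚ p) c-homogeneous))
  where
  gen⊗lastFrom : (g : Gen n) (v : Fin (suc n)) → Homogeneous 2 (gen g ⊗ lastFrom v)
  gen⊗lastFrom g v = Homogeneous-⊗ {x = gen g} (refl ∷ []) (sumGens-homogeneous (edgesFrom v))
  c-homogeneous : Homogeneous 2 (cOS n)
  c-homogeneous = sumFA-homogeneous _ (λ g → Allₚ.++⁺ (gen⊗lastFrom g (src g)) (gen⊗lastFrom g (tgt g))) (edgesA n)

lin-∂-gOS : (φ : Word n → ℚ) (p : ℕ) → lin φ (∂ (gOS n p)) ≡
  (count (edgesA n) * lin φ (mOS n) + - (ℕ→ℚ n * lin φ (aOS n)))
    + - (ℕ→ℚ p * ((ℕ→ℚ n + - 1ℚ) * lin φ (mOS n) + - ((1ℚ + 1ℚ) * lin φ (aOS n))))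
lin-∂-gOS {n} φ p = begin
  lin φ (∂ ((aOS n ⊗ mOS n) ⊕ (⊖ (P · cOS n))))
    ≡⟨ trans (lin-≡ (∂-⊕ (aOS n ⊗ mOS n) (⊖ (P · cOS n))) φ) (lin-⊕ φ (∂ (aOS n ⊗ mOS n)) (∂ (⊖ (P · cOS n)))) ⟩
  lin φ (∂ (aOS n ⊗ mOS n)) + lin φ (∂ (⊖ (P · cOS n)))
    ≡⟨ cong (lin φ (∂ (aOS n ⊗ mOS n)) +_) (trans (lin-≡ (∂-· (- 1ℚ) (P · cOS n)) φ) (lin-⊖ φ (∂ (P · cOS n)))) ⟩
  lin φ (∂ (aOS n ⊗ mOS n)) + - lin φ (∂ (P · cOS n))
    ≡⟨ cong (λ t → lin φ (∂ (aOS n ⊗ mOS n)) + - t) (trans (lin-≡ (∂-· P (cOS n)) φ) (lin-· φ P (∂ (cOS n)))) ⟩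
  lin φ (∂ (aOS n ⊗ mOS n)) + - (P * lin φ (∂ (cOS n)))
    ≡⟨ cong₂ (λ s t → s + - (P * t)) (trans (lin-≡ ∂-aOS⊗mOS φ) (lin-combination φ (count (edgesA n)) N (mOS n) (aOS n)))
                                     (trans (lin-≡ ∂-cOS φ) (lin-combination φ (N + - 1ℚ) (1ℚ + 1ℚ) (mOS n) (aOS n))) ⟩
  (count (edgesA n) * lin φ (mOS n) + - (N * lin φ (aOS n)))
    + - (P * ((N + - 1ℚ) * lin φ (mOS n) + - ((1ℚ + 1ℚ) * lin φ (aOS n)))) ∎
  where
  P = ℕ→ℚ p
  N = ℕ→ℚ n

∂-gOS-odd : (k : ℕ) → let n = suc (k ℕ.* 2) in ∂ (gOS n (suc k)) ≐ aOS n ⊕ (⊖ (ℕ→ℚ k · mOS n))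
∂-gOS-odd k = mk≐ λ φ → let SA = lin φ (aOS 2k+1) ; SM = lin φ (mOS 2k+1) in begin
  lin φ (∂ (gOS 2k+1 (suc k)))
    ≡⟨ lin-∂-gOS φ (suc k) ⟩
  (count (edgesA 2k+1) * SM + - (ℕ→ℚ 2k+1 * SA)) + - (ℕ→ℚ (suc k) * ((ℕ→ℚ 2k+1 + - 1ℚ) * SM + - ((1ℚ + 1ℚ) * SA)))
    ≡⟨ cong₃ (λ A N P → (A * SM + - (N * SA)) + - (P * ((N + - 1ℚ) * SM + - ((1ℚ + 1ℚ) * SA))))
             (count-edgesA-odd k) (ℕ→ℚ-odd k) (ℕ→ℚ-suc k) ⟩
  (K * (1ℚ + (K + K)) * SM + - ((1ℚ + (K + K)) * SA)) + - ((1ℚ + K) * (((1ℚ + (K + K)) + - 1ℚ) * SM + - ((1ℚ + 1ℚ) * SA)))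
    ≡⟨ simplify K SA SM ⟩
  SA + - (K * SM)
    ≡⟨ sym (trans (lin-⊕⊖ φ (aOS 2k+1) (K · mOS 2k+1)) (cong (λ t → SA + - t) (lin-· φ K (mOS 2k+1)))) ⟩
  lin φ (aOS 2k+1 ⊕ (⊖ (K · mOS 2k+1))) ∎
  where
  2k+1 = suc (k ℕ.* 2)
  K = ℕ→ℚ k
  cong₃ : {a a' b b' c c' : ℚ} (f : ℚ → ℚ → ℚ → ℚ) → a ≡ a' → b ≡ b' → c ≡ c' → f a b c ≡ f a' b' c'
  cong₃ f refl refl refl = refl
  simplify : ∀ k a m → (k * (1ℚ + (k + k)) * m + - ((1ℚ + (k + k)) * a))
                       + - ((1ℚ + k) * (((1ℚ + (k + k)) + - 1ℚ) * m + - ((1ℚ + 1ℚ) * a))) ≡ a + - (k * m)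
  simplify = solve-∀ ℚ-ring

a⊗gᵏ≈k·m⊗gᵏ : (k : ℕ) → let n = suc (k ℕ.* 2) in
  (aOS n ⊗ (gOS n (suc k) ^^ k)) ≈OS (ℕ→ℚ k · (mOS n ⊗ (gOS n (suc k) ^^ k)))
a⊗gᵏ≈k·m⊗gᵏ k = Ideal⇒InIdeal (resp expand (Ideal-cancel k (≈[]⇒Ideal ∂gᵏ⁺¹≈0)))
  where
  2k+1 = suc (k ℕ.* 2)
  g = gOS 2k+1 (suc k)
  hom = gOS-homogeneous (suc k)
  gᵏ⁺¹∈I : Ideal (g ^^ suc k)
  gᵏ⁺¹∈I = Homogeneous-vanishes ℕₚ.≤-refl (Homogeneous-^^ hom (suc k))
  ∂gᵏ⁺¹≈0 : ℕ→ℚ (suc k) · (∂ g ⊗ (g ^^ k)) ≈ []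
  ∂gᵏ⁺¹≈0 = ≈-trans (≈-sym (∂-^^ hom k)) (Ideal⇒≈[] (∂-Ideal gᵏ⁺¹∈I))
  expand : ∂ g ⊗ (g ^^ k) ≐ (aOS 2k+1 ⊗ (g ^^ k)) ⊕ (⊖ (ℕ→ℚ k · (mOS 2k+1 ⊗ (g ^^ k))))
  expand = ≐-trans (⊗-congˡ (g ^^ k) (∂-gOS-odd k))
    (≐-trans (⊗-distribʳ-⊕ (aOS 2k+1) (⊖ (ℕ→ℚ k · mOS 2k+1)) (g ^^ k))
      (⊕-congʳ (aOS 2k+1 ⊗ (g ^^ k)) (≐-trans (⊗-·ˡ (- 1ℚ) (ℕ→ℚ k · mOS 2k+1) (g ^^ k)) (·-cong (- 1ℚ) (⊗-·ˡ (ℕ→ℚ k) (mOS 2k+1) (g ^^ k))))))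

n≡1+[n/2]*2 : (n : ℕ) → n % 2 ≡ 1 → n ≡ suc (n / 2 ℕ.* 2)
n≡1+[n/2]*2 n n-odd = trans (m≡m%n+[m/n]*n n 2) (cong (ℕ._+ n / 2 ℕ.* 2) n-odd)

[2+k*2]/2≡1+k : (k : ℕ) → suc (suc (k ℕ.* 2)) / 2 ≡ suc k
[2+k*2]/2≡1+k k = m*n/n≡m (suc k) 2

lemma6p5 : (n : ℕ) → n ≥ 3 → n % 2 ≡ 1 →
    let p = suc n / 2
        g = (aOS n ⊗ mOS n) ⊕ (⊖ (ℕ→ℚ p · cOS n))
    in (aOS n ⊗ (g ^^ (p ∸ 1))) ≈OS (ℕ→ℚ (p ∸ 1) · (mOS n ⊗ (g ^^ (p ∸ 1))))
lemma6p5 n _ n-odd rewrite n≡1+[n/2]*2 n n-odd | [2+k*2]/2≡1+k (n / 2) = a⊗gᵏ≈k·m⊗gᵏ (n / 2)
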